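{- Let $\Sigma=(B,K,E,\mathrm{ar},\mathrm{car})$ be a $\lambda_c$-signature and $\mathcal{A}=(\mathbb{C},T,A,a)$ a $\lambda_c(\Sigma)$-structure. Let $U$ be a strong monad on $\mathbb{C}$ and $\alpha\colon T\Rightarrow U$ a strong monad morphism. Let $\tau^T\colon T(\Omega^T)\to\Omega^T$ and $\tau^U\colon U(\Omega^U)\to\Omega^U$ be Eilenberg–Moore algebras and let $q\colon\Omega^T\to\Omega^U$ be an inference query for $\alpha,\tau^T,\tau^U$. Let $\Gamma\vdash M\colon\mathbf{t}$ be a well-typed term such that all types in $\Gamma$ and $\mathbf{t}$ are ground types, and let $Q\colon[\![\mathbf{t}]\!]\to\Omega^T$ be a morphism (a post-condition). Then $$q\circ \mathrm{wp}^{\mathcal{A}}_{\tau^T}[M](Q)=\mathrm{wp}^{\alpha(\mathcal{A})}_{\tau^U}[M](q\circ Q)$$ as morphisms $[\![\Gamma]\!]\to\Omega^U$.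
   Context: Standing conventions: $\mathbb{C}$ is a bicartesian closed category (bi-CCC) which is stable (binary coproducts are stable under pullback). $\mathrm{ev}_{X,Y}\colon X^Y\times Y\to X$ is evaluation and $(\cdot)^\dagger$ denotes transposition (currying/uncurrying) along $(-\times Y)\dashv(-)^Y$. A strong monad $(T,\eta^T,\mu^T,\mathrm{st}^T)$ has left strength $\mathrm{st}^T_{X,W}\colon X\times TW\to T(X\times W)$ and induced right strength $\mathrm{st}'^T_{W,X}\colon TW\times X\to T(W\times X)$. Syntax: given a set $B$ of base types, types are $\mathbf{t}::=b\mid\mathbf{1}\mid\mathbf{t}_1\times\mathbf{t}_2\mid\mathbf{0}\mid\mathbf{t}_1+\mathbf{t}_2\mid\mathbf{t}_1\to\mathbf{t}_2$ ($b\in B$); ground types are those not containing $\to$. A $\lambda_c$-signature $\Sigma=(B,K,E,\mathrm{ar},\mathrm{car})$ consists of $B$, a set $K$ of effect-free constants, a set $E$ of generic effects, and maps $\mathrm{ar},\mathrm{car}\colon K+E\to$ ground types. Terms: $M,N::=x\mid c\,M\mid e\,M\mid()\mid(M,N)\mid\pi_iM\mid\delta(M)\mid\iota_iM\mid\delta(M,x_1\colon\mathbf{t}_1.N_1,x_2\colon\mathbf{t}_2.N_2)\mid\lambda x\colon\mathbf{t}.M\mid M\,N$, typed by the standard rules of the simply typed call-by-value $\lambda$-calculus with products and sums, where $c\,M\colon\mathrm{car}(c)$ if $M\colon\mathrm{ar}(c)$, $e\,M\colon\mathrm{car}(e)$ if $M\colon\mathrm{ar}(e)$, and $\delta(M)\colon\mathbf{t}$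 (any $\mathbf{t}$) if $M\colon\mathbf{0}$. A $\lambda_c(\Sigma)$-structure $\mathcal{A}=(\mathbb{C},T,A,a)$ consists of $\mathbb{C}$, a strong monad $T$ on $\mathbb{C}$, an object $A(b)$ for each $b\in B$, and an assignment $a$ with $a(c)\colon[\![\mathrm{ar}(c)]\!]\to[\![\mathrm{car}(c)]\!]$ for $c\in K$ and $a(e)\colon[\![\mathrm{ar}(e)]\!]\to T[\![\mathrm{car}(e)]\!]$ for $e\in E$. Types are interpreted by $[\![b]\!]=A(b)$, $\mathbf{1},\times,\mathbf{0},+$ by the bi-CCC structure, and $[\![\mathbf{t}_1\to\mathbf{t}_2]\!]=T([\![\mathbf{t}_2]\!])^{[\![\mathbf{t}_1]\!]}$; contexts by $[\![x_1\colon\mathbf{t}_1,\dots,x_n\colon\mathbf{t}_n]\!]=\prod_i[\![\mathbf{t}_i]\!]$. (On ground types the interpretation does not depend on the monad.) A well-typed term $\Gamma\vdash M\colon\mathbf{t}$ is interpreted as $[\![M]\!]^{\mathcal{A}}\colon[\![\Gamma]\!]\to T[\![\mathbf{t}]\!]$ by Moggi's standard call-by-value monadic semantics: $[\![x_i]\!]=\eta\circ\pi_i$; $[\![()]\!]=\eta\circ{!}$; $[\![c\,M]\!]=T(a(c))\circ[\![M]\!]$; $[\![e\,M]\!]=\mu\circ T(a(e))\circ[\![M]\!]$; $[\![(M,N)]\!]=\mu\circ T(\mathrm{st})\circ\mathrm{st}'\circ\langle[\![M]\!],[\![N]\!]\rangle$; $[\![\pi_iM]\!]=T(\pi_i)\circ[\![M]\!]$;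 $[\![\iota_iM]\!]=T(\iota_i)\circ[\![M]\!]$; $[\![\delta(M)]\!]=T(!)\circ[\![M]\!]$; $[\![\delta(M,x_1.N_1,x_2.N_2)]\!]=\mu\circ T([[\![N_1]\!],[\![N_2]\!]]\circ\mathrm{dist})\circ\mathrm{st}\circ\langle\mathrm{id},[\![M]\!]\rangle$ with $\mathrm{dist}$ the distributivity isomorphism; $[\![\lambda x.M]\!]=\eta\circ[\![M]\!]^\dagger$; $[\![M\,N]\!]=\mu\circ T(\mu)\circ T^2(\mathrm{ev})\circ T(\mathrm{st})\circ\mathrm{st}'\circ\langle[\![M]\!],[\![N]\!]\rangle$. Weakest pre-condition: for an Eilenberg–Moore algebra $\tau\colon T\Omega\to\Omega$, a well-typed $\Gamma\vdash M\colon\mathbf{t}$ and $Q\colon[\![\mathbf{t}]\!]\to\Omega$, $\mathrm{wp}^{\mathcal{A}}_{\tau}[M](Q):=\tau\circ T(Q)\circ[\![M]\!]^{\mathcal{A}}\colon[\![\Gamma]\!]\to\Omega$. A strong monad morphism $\alpha\colon T\Rightarrow U$ is a natural transformation with $\alpha\circ\eta^T=\eta^U$, $\alpha\circ\mu^T=\mu^U\circ U(\alpha)\circ\alpha_T$, and $\alpha_{X\times Y}\circ\mathrm{st}^T=\mathrm{st}^U\circ(\mathrm{id}_X\times\alpha_Y)$. Given such $\alpha$, $\alpha(\mathcal{A})$ is the $\lambda_c(\Sigma)$-structure $(\mathbb{C},U,A,\alpha(a))$ with $\alpha(a)(c)=a(c)$ and $\alpha(a)(e)=\alpha_{[\![\mathrm{car}(e)]\!]}\circ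 a(e)$. An inference query for $\alpha,\tau^T,\tau^U$ is a morphism $q\colon\Omega^T\to\Omega^U$ with $q\circ\tau^T=\tau^U\circ U(q)\circ\alpha_{\Omega^T}$. -}

module Defs where

open import Level using (Level; _⊔_; suc)
open import Data.Product using (Σ; Σ-syntax; _×_; _,_)
open import Data.Sum using (_⊎_; inj₁; inj₂)
open import Relation.Binary.PropositionalEquality using (_≡_; refl; sym; cong; cong₂; subst)
open import Relation.Binary.Structures using (IsEquivalence)

record Category (o ℓ e : Level) : Set (suc (o ⊔ ℓ ⊔ e)) where
  infixr 9 _∘_
  infix 4 _≈_
  field
    Obj   : Set o
    Hom   : Obj → Obj → Set ℓ
    _≈_   : ∀ {X Y} → Hom X Y → Hom X Y → Set e
    ≈-equiv : ∀ {X Y} → IsEquivalence (_≈_ {X} {Y})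
    id    : ∀ {X} → Hom X X
    _∘_   : ∀ {X Y Z} → Hom Y Z → Hom X Y → Hom X Z
    ∘-cong : ∀ {X Y Z} {f f' : Hom Y Z} {g g' : Hom X Y} →
             f ≈ f' → g ≈ g' → f ∘ g ≈ f' ∘ g'
    identityˡ : ∀ {X Y} {f : Hom X Y} → id ∘ f ≈ f
    identityʳ : ∀ {X Y} {f : Hom X Y} → f ∘ id ≈ f
    assoc : ∀ {W X Y Z} {f : Hom Y Z} {g : Hom X Y} {h : Hom W X} →
            (f ∘ g) ∘ h ≈ f ∘ (g ∘ h)

module CatNotions {o ℓ e} (C : Category o ℓ e) where
  open Category C

  IsIso : ∀ {X Y} → Hom X Y → Set (ℓ ⊔ e)
  IsIso {X} {Y} h = Σ[ g ∈ Hom Y X ] ((g ∘ h ≈ id) × (h ∘ g ≈ id))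

  IsPullback : ∀ {P X Y Z} → Hom P X → Hom P Y → Hom X Z → Hom Y Z →
               Set (o ⊔ ℓ ⊔ e)
  IsPullback {P} {X} {Y} {Z} p₁ p₂ f g =
    (f ∘ p₁ ≈ g ∘ p₂) ×
    (∀ {Q} (h₁ : Hom Q X) (h₂ : Hom Q Y) → f ∘ h₁ ≈ g ∘ h₂ →
      Σ[ u ∈ Hom Q P ] ((p₁ ∘ u ≈ h₁) × (p₂ ∘ u ≈ h₂) ×
        (∀ (v : Hom Q P) → p₁ ∘ v ≈ h₁ → p₂ ∘ v ≈ h₂ → v ≈ u)))

record StableBiCCC {o ℓ e} (C : Category o ℓ e) : Set (o ⊔ ℓ ⊔ e) where
  open Category C
  open CatNotions C
  infixr 7 _⊗_
  infixr 6 _⊕_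
  field
    𝟙 : Obj
    ! : ∀ {X} → Hom X 𝟙
    !-unique : ∀ {X} (f : Hom X 𝟙) → f ≈ !
    _⊗_ : Obj → Obj → Obj
    π₁ : ∀ {X Y} → Hom (X ⊗ Y) X
    π₂ : ∀ {X Y} → Hom (X ⊗ Y) Y
    ⟨_,_⟩ : ∀ {Z X Y} → Hom Z X → Hom Z Y → Hom Z (X ⊗ Y)
    π₁-β : ∀ {Z X Y} {f : Hom Z X} {g : Hom Z Y} → π₁ ∘ ⟨ f , g ⟩ ≈ f
    π₂-β : ∀ {Z X Y} {f : Hom Z X} {g : Hom Z Y} → π₂ ∘ ⟨ f , g ⟩ ≈ g
    ⟨⟩-unique : ∀ {Z X Y} {f : Hom Z X} {g : Hom Z Y} (h : Hom Z (X ⊗ Y)) →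
                π₁ ∘ h ≈ f → π₂ ∘ h ≈ g → h ≈ ⟨ f , g ⟩
    𝟘 : Obj
    ¡ : ∀ {X} → Hom 𝟘 X
    ¡-unique : ∀ {X} (f : Hom 𝟘 X) → f ≈ ¡
    _⊕_ : Obj → Obj → Obj
    ι₁ : ∀ {X Y} → Hom X (X ⊕ Y)
    ι₂ : ∀ {X Y} → Hom Y (X ⊕ Y)
    [_,_] : ∀ {X Y Z} → Hom X Z → Hom Y Z → Hom (X ⊕ Y) Z
    ι₁-β : ∀ {X Y Z} {f : Hom X Z} {g : Hom Y Z} → [ f , g ] ∘ ι₁ ≈ f
    ι₂-β : ∀ {X Y Z} {f : Hom X Z} {g : Hom Y Z} → [ f , g ] ∘ ι₂ ≈ g
    []-unique : ∀ {X Y Z} {f : Hom X Z} {g : Hom Y Z} (h : Hom (X ⊕ Y) Z) →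
                h ∘ ι₁ ≈ f → h ∘ ι₂ ≈ g → h ≈ [ f , g ]
    -- exponentials: (- ⊗ Y) ⊣ (-)^Y ;  Exp X Y = X^Y
    Exp : Obj → Obj → Obj
    ev : ∀ {X Y} → Hom (Exp X Y ⊗ Y) X
    curry : ∀ {Z X Y} → Hom (Z ⊗ Y) X → Hom Z (Exp X Y)
    ev-β : ∀ {Z X Y} {f : Hom (Z ⊗ Y) X} →
           ev ∘ ⟨ curry f ∘ π₁ , id ∘ π₂ ⟩ ≈ f
    curry-unique : ∀ {Z X Y} {f : Hom (Z ⊗ Y) X} (h : Hom Z (Exp X Y)) →
                   ev ∘ ⟨ h ∘ π₁ , id ∘ π₂ ⟩ ≈ f → h ≈ curry f
    -- stability: binary coproducts are stable under pullback
    stable : ∀ {Z X Y} (f : Hom Z (X ⊕ Y)) →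
      Σ[ Z₁ ∈ Obj ] Σ[ Z₂ ∈ Obj ]
      Σ[ p₁ ∈ Hom Z₁ Z ] Σ[ k₁ ∈ Hom Z₁ X ] Σ[ p₂ ∈ Hom Z₂ Z ] Σ[ k₂ ∈ Hom Z₂ Y ]
        (IsPullback p₁ k₁ f ι₁ × IsPullback p₂ k₂ f ι₂ × IsIso [ p₁ , p₂ ])

  _⊗₁_ : ∀ {X Y X' Y'} → Hom X X' → Hom Y Y' → Hom (X ⊗ Y) (X' ⊗ Y')
  f ⊗₁ g = ⟨ f ∘ π₁ , g ∘ π₂ ⟩

  swap : ∀ {X Y} → Hom (X ⊗ Y) (Y ⊗ X)
  swap = ⟨ π₂ , π₁ ⟩

  ×-assoc : ∀ {X Y W} → Hom ((X ⊗ Y) ⊗ W) (X ⊗ (Y ⊗ W))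
  ×-assoc = ⟨ π₁ ∘ π₁ , ⟨ π₂ ∘ π₁ , π₂ ⟩ ⟩

  uncurry : ∀ {Z X Y} → Hom Z (Exp X Y) → Hom (Z ⊗ Y) X
  uncurry h = ev ∘ (h ⊗₁ id)

  -- the distributivity isomorphism  X × (Y + Z) ≅ X × Y + X × Z
  -- (inverse of [ id × ι₁ , id × ι₂ ], constructed via exponentials)
  dist : ∀ {X Y Z} → Hom (X ⊗ (Y ⊕ Z)) ((X ⊗ Y) ⊕ (X ⊗ Z))
  dist = uncurry [ curry (ι₁ ∘ swap) , curry (ι₂ ∘ swap) ] ∘ swap

module _ {o ℓ e} {C : Category o ℓ e} (S : StableBiCCC C) where
  open Category C
  open StableBiCCC S

  record StrongMonad : Set (o ⊔ ℓ ⊔ e) where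
    field
      T₀ : Obj → Obj
      T₁ : ∀ {X Y} → Hom X Y → Hom (T₀ X) (T₀ Y)
      T₁-cong : ∀ {X Y} {f g : Hom X Y} → f ≈ g → T₁ f ≈ T₁ g
      T₁-id : ∀ {X} → T₁ (id {X}) ≈ id
      T₁-∘ : ∀ {X Y Z} {f : Hom Y Z} {g : Hom X Y} → T₁ (f ∘ g) ≈ T₁ f ∘ T₁ g
      η : ∀ {X} → Hom X (T₀ X)
      μ : ∀ {X} → Hom (T₀ (T₀ X)) (T₀ X)
      η-natural : ∀ {X Y} {f : Hom X Y} → η ∘ f ≈ T₁ f ∘ η
      μ-natural : ∀ {X Y} {f : Hom X Y} → μ ∘ T₁ (T₁ f) ≈ T₁ f ∘ μ
      μ-η : ∀ {X} → μ ∘ η {T₀ X} ≈ id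
      μ-Tη : ∀ {X} → μ ∘ T₁ (η {X}) ≈ id
      μ-assoc : ∀ {X} → μ ∘ T₁ (μ {X}) ≈ μ ∘ μ
      st : ∀ {X W} → Hom (X ⊗ T₀ W) (T₀ (X ⊗ W))
      st-natural : ∀ {X X' W W'} {f : Hom X X'} {g : Hom W W'} →
                   st ∘ (f ⊗₁ T₁ g) ≈ T₁ (f ⊗₁ g) ∘ st
      st-unit : ∀ {W} → T₁ π₂ ∘ st {𝟙} {W} ≈ π₂
      st-assoc : ∀ {X Y W} →
        st {X} {Y ⊗ W} ∘ (id ⊗₁ st {Y} {W}) ∘ ×-assoc ≈ T₁ ×-assoc ∘ st {X ⊗ Y} {W}
      st-η : ∀ {X W} → st {X} {W} ∘ (id ⊗₁ η) ≈ η
      st-μ : ∀ {X W} → st {X} {W} ∘ (id ⊗₁ μ) ≈ μ ∘ T₁ st ∘ st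

    st' : ∀ {W X} → Hom (T₀ W ⊗ X) (T₀ (W ⊗ X))
    st' = T₁ swap ∘ st ∘ swap

  record MonadMorphism (T U : StrongMonad) : Set (o ⊔ ℓ ⊔ e) where
    private
      module T = StrongMonad T
      module U = StrongMonad U
    field
      α : ∀ {X} → Hom (T.T₀ X) (U.T₀ X)
      α-natural : ∀ {X Y} {f : Hom X Y} → α ∘ T.T₁ f ≈ U.T₁ f ∘ α
      α-η : ∀ {X} → α ∘ T.η {X} ≈ U.η
      α-μ : ∀ {X} → α ∘ T.μ {X} ≈ U.μ ∘ U.T₁ α ∘ α {T.T₀ X}
      α-st : ∀ {X Y} → α {X ⊗ Y} ∘ T.st ≈ U.st ∘ (id ⊗₁ α)

  record EMAlgebra (T : StrongMonad) (Ω : Obj) : Set (ℓ ⊔ e) where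
    open StrongMonad T
    field
      τ : Hom (T₀ Ω) Ω
      τ-η : τ ∘ η ≈ id
      τ-μ : τ ∘ μ ≈ τ ∘ T₁ τ

  record InferenceQuery {T U : StrongMonad} (α : MonadMorphism T U)
         {ΩT ΩU : Obj} (τT : EMAlgebra T ΩT) (τU : EMAlgebra U ΩU) : Set (ℓ ⊔ e) where
    field
      q : Hom ΩT ΩU
      q-hom : q ∘ EMAlgebra.τ τT ≈
              EMAlgebra.τ τU ∘ StrongMonad.T₁ U q ∘ MonadMorphism.α α

data Ty (B : Set) : Set where
  base : B → Ty B
  𝟏 : Ty B
  _×ᵗ_ : Ty B → Ty B → Ty B
  𝟎 : Ty B
  _+ᵗ_ : Ty B → Ty B → Ty B
  _⇒_ : Ty B → Ty B → Ty B

data GTy (B : Set) : Set where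
  base : B → GTy B
  𝟏 : GTy B
  _×ᵍ_ : GTy B → GTy B → GTy B
  𝟎 : GTy B
  _+ᵍ_ : GTy B → GTy B → GTy B

⌜_⌝ : ∀ {B} → GTy B → Ty B
⌜ base b ⌝ = base b
⌜ 𝟏 ⌝ = 𝟏
⌜ g ×ᵍ h ⌝ = ⌜ g ⌝ ×ᵗ ⌜ h ⌝
⌜ 𝟎 ⌝ = 𝟎
⌜ g +ᵍ h ⌝ = ⌜ g ⌝ +ᵗ ⌜ h ⌝

record Signature : Set₁ where
  field
    B : Set
    K : Set
    E : Set
    ar  : K ⊎ E → GTy B
    car : K ⊎ E → GTy B

data Ctx (B : Set) : Set where
  ∅ : Ctx B
  _▸_ : Ctx B → Ty B → Ctx B

data GCtx (B : Set) : Set where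
  ∅ : GCtx B
  _▸_ : GCtx B → GTy B → GCtx B

⌜_⌝c : ∀ {B} → GCtx B → Ctx B
⌜ ∅ ⌝c = ∅
⌜ Γ ▸ g ⌝c = ⌜ Γ ⌝c ▸ ⌜ g ⌝

data _∋_ {B : Set} : Ctx B → Ty B → Set where
  here  : ∀ {Γ t} → (Γ ▸ t) ∋ t
  there : ∀ {Γ s t} → Γ ∋ t → (Γ ▸ s) ∋ t

module Terms (Sg : Signature) where
  open Signature Sg

  infix 3 _⊢_
  data _⊢_ (Γ : Ctx B) : Ty B → Set where
    var  : ∀ {t} → Γ ∋ t → Γ ⊢ t
    con  : (c : K) → Γ ⊢ ⌜ ar (inj₁ c) ⌝ → Γ ⊢ ⌜ car (inj₁ c) ⌝
    eff  : (ε : E) → Γ ⊢ ⌜ ar (inj₂ ε) ⌝ → Γ ⊢ ⌜ car (inj₂ ε) ⌝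
    unit : Γ ⊢ 𝟏
    pair : ∀ {t₁ t₂} → Γ ⊢ t₁ → Γ ⊢ t₂ → Γ ⊢ t₁ ×ᵗ t₂
    fst  : ∀ {t₁ t₂} → Γ ⊢ t₁ ×ᵗ t₂ → Γ ⊢ t₁
    snd  : ∀ {t₁ t₂} → Γ ⊢ t₁ ×ᵗ t₂ → Γ ⊢ t₂
    absurd : ∀ {t} → Γ ⊢ 𝟎 → Γ ⊢ t
    inl  : ∀ {t₁ t₂} → Γ ⊢ t₁ → Γ ⊢ t₁ +ᵗ t₂
    inr  : ∀ {t₁ t₂} → Γ ⊢ t₂ → Γ ⊢ t₁ +ᵗ t₂
    case : ∀ {t₁ t₂ t} → Γ ⊢ t₁ +ᵗ t₂ → (Γ ▸ t₁) ⊢ t → (Γ ▸ t₂) ⊢ t → Γ ⊢ t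
    lam  : ∀ {t₁ t₂} → (Γ ▸ t₁) ⊢ t₂ → Γ ⊢ t₁ ⇒ t₂
    app  : ∀ {t₁ t₂} → Γ ⊢ t₁ ⇒ t₂ → Γ ⊢ t₁ → Γ ⊢ t₂

module Semantics {o ℓ e} {C : Category o ℓ e} (S : StableBiCCC C) (Sg : Signature) where
  open Category C
  open StableBiCCC S
  open Signature Sg
  open Terms Sg public

  ≡⇒Hom : ∀ {X Y} → X ≡ Y → Hom X Y
  ≡⇒Hom {X} p = subst (Hom X) p id

  -- interpretation of ground types (independent of the monad)
  ⟦_⟧g : GTy B → (B → Obj) → Obj
  ⟦ base b ⟧g A = A b
  ⟦ 𝟏 ⟧g A = 𝟙
  ⟦ g ×ᵍ h ⟧g A = ⟦ g ⟧g A ⊗ ⟦ h ⟧g A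
  ⟦ 𝟎 ⟧g A = 𝟘
  ⟦ g +ᵍ h ⟧g A = ⟦ g ⟧g A ⊕ ⟦ h ⟧g A

  ⟦_⟧gc : GCtx B → (B → Obj) → Obj
  ⟦ ∅ ⟧gc A = 𝟙
  ⟦ Γ ▸ g ⟧gc A = ⟦ Γ ⟧gc A ⊗ ⟦ g ⟧g A

  record Structure (T : StrongMonad S) : Set (o ⊔ ℓ) where
    open StrongMonad T
    field
      A  : B → Obj
      aK : (c : K) → Hom (⟦ ar (inj₁ c) ⟧g A) (⟦ car (inj₁ c) ⟧g A)
      aE : (ε : E) → Hom (⟦ ar (inj₂ ε) ⟧g A) (T₀ (⟦ car (inj₂ ε) ⟧g A))

  pushStructure : ∀ {T U : StrongMonad S} → MonadMorphism S T U →
                  Structure T → Structure U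
  pushStructure α 𝒜 = record
    { A = Structure.A 𝒜
    ; aK = Structure.aK 𝒜
    ; aE = λ ε → MonadMorphism.α α ∘ Structure.aE 𝒜 ε }

  module Interp {T : StrongMonad S} (𝒜 : Structure T) where
    open StrongMonad T
    open Structure 𝒜

    ⟦_⟧ty : Ty B → Obj
    ⟦ base b ⟧ty = A b
    ⟦ 𝟏 ⟧ty = 𝟙
    ⟦ s ×ᵗ t ⟧ty = ⟦ s ⟧ty ⊗ ⟦ t ⟧ty
    ⟦ 𝟎 ⟧ty = 𝟘
    ⟦ s +ᵗ t ⟧ty = ⟦ s ⟧ty ⊕ ⟦ t ⟧ty
    ⟦ s ⇒ t ⟧ty = Exp (T₀ ⟦ t ⟧ty) ⟦ s ⟧ty

    ⟦_⟧ctx : Ctx B → Obj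
    ⟦ ∅ ⟧ctx = 𝟙
    ⟦ Γ ▸ t ⟧ctx = ⟦ Γ ⟧ctx ⊗ ⟦ t ⟧ty

    ground≡ : (g : GTy B) → ⟦ ⌜ g ⌝ ⟧ty ≡ ⟦ g ⟧g A
    ground≡ (base b) = refl
    ground≡ 𝟏 = refl
    ground≡ (g ×ᵍ h) = cong₂ _⊗_ (ground≡ g) (ground≡ h)
    ground≡ 𝟎 = refl
    ground≡ (g +ᵍ h) = cong₂ _⊕_ (ground≡ g) (ground≡ h)

    groundCtx≡ : (Γ : GCtx B) → ⟦ ⌜ Γ ⌝c ⟧ctx ≡ ⟦ Γ ⟧gc A
    groundCtx≡ ∅ = refl
    groundCtx≡ (Γ ▸ g) = cong₂ _⊗_ (groundCtx≡ Γ) (ground≡ g)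

    ⟦_⟧var : ∀ {Γ t} → Γ ∋ t → Hom ⟦ Γ ⟧ctx ⟦ t ⟧ty
    ⟦ here ⟧var = π₂
    ⟦ there x ⟧var = ⟦ x ⟧var ∘ π₁

    ⟦_⟧ : ∀ {Γ t} → Γ ⊢ t → Hom ⟦ Γ ⟧ctx (T₀ ⟦ t ⟧ty)
    ⟦ var x ⟧ = η ∘ ⟦ x ⟧var
    ⟦ con c M ⟧ = T₁ (≡⇒Hom (sym (ground≡ (car (inj₁ c)))) ∘ aK c ∘
                      ≡⇒Hom (ground≡ (ar (inj₁ c)))) ∘ ⟦ M ⟧
    ⟦ eff ε M ⟧ = μ ∘ T₁ (T₁ (≡⇒Hom (sym (ground≡ (car (inj₂ ε))))) ∘ aE ε ∘
                      ≡⇒Hom (ground≡ (ar (inj₂ ε)))) ∘ ⟦ M ⟧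
    ⟦ unit ⟧ = η ∘ !
    ⟦ pair M N ⟧ = μ ∘ T₁ st ∘ st' ∘ ⟨ ⟦ M ⟧ , ⟦ N ⟧ ⟩
    ⟦ fst M ⟧ = T₁ π₁ ∘ ⟦ M ⟧
    ⟦ snd M ⟧ = T₁ π₂ ∘ ⟦ M ⟧
    ⟦ absurd M ⟧ = T₁ ¡ ∘ ⟦ M ⟧
    ⟦ inl M ⟧ = T₁ ι₁ ∘ ⟦ M ⟧
    ⟦ inr M ⟧ = T₁ ι₂ ∘ ⟦ M ⟧
    ⟦ case M N₁ N₂ ⟧ = μ ∘ T₁ ([ ⟦ N₁ ⟧ , ⟦ N₂ ⟧ ] ∘ dist) ∘ st ∘ ⟨ id , ⟦ M ⟧ ⟩
    ⟦ lam M ⟧ = η ∘ curry ⟦ M ⟧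
    ⟦ app M N ⟧ = μ ∘ T₁ μ ∘ T₁ (T₁ ev) ∘ T₁ st ∘ st' ∘ ⟨ ⟦ M ⟧ , ⟦ N ⟧ ⟩

    wp : ∀ {Ω} → EMAlgebra S T Ω → ∀ {Γ t} → Γ ⊢ t →
         Hom ⟦ t ⟧ty Ω → Hom ⟦ Γ ⟧ctx Ω
    wp τ M Q = EMAlgebra.τ τ ∘ T₁ Q ∘ ⟦ M ⟧

    -- wp for a term with ground context Γ and ground type t, read as a
    -- morphism ⟦Γ⟧ → Ω with a post-condition ⟦t⟧ → Ω, via the canonical
    -- identification of ground-type interpretations
    wpG : ∀ {Ω} → EMAlgebra S T Ω → (Γ : GCtx B) (t : GTy B) →
          ⌜ Γ ⌝c ⊢ ⌜ t ⌝ → Hom (⟦ t ⟧g A) Ω → Hom (⟦ Γ ⟧gc A) Ω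
    wpG τ Γ t M Q = wp τ M (Q ∘ ≡⇒Hom (ground≡ t)) ∘ ≡⇒Hom (sym (groundCtx≡ Γ))

-- The two interpretations of M cannot be compared directly, since they interpret function
-- types differently (T ⟦t⟧ ^ ⟦s⟧ versus U ⟦t⟧ ^ ⟦s⟧).  Instead we use a Kripke logical
-- relation between generalized elements Z → ⟦t⟧ of the two models, in which two computations
-- are related when they are T p ∘ w and U r ∘ α ∘ w for a single w : Z → T W and related
-- results p, r.  As α is a strong monad morphism, the relation is preserved by unit, strength
-- and Kleisli extension; as coproducts are stable, it is closed under copairing, which case
-- analysis needs at function types.  On ground types it is equality up to the canonical
-- identifications, so the fundamental lemma presents both semantics of M as images of one
-- T-computation w, and the inference-query square q ∘ τᵀ = τᵁ ∘ U q ∘ α carries wp along w.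

module Submission where

open import Level using (Level; Lift; lift; lower; _⊔_)
open import Data.Product using (_×_; _,_; proj₁; proj₂)
open import Data.Unit.Polymorphic using (⊤; tt)
open import Data.Sum using (inj₁; inj₂)
open import Relation.Binary.Bundles using (Setoid)
open import Relation.Binary.PropositionalEquality as ≡ using (_≡_; refl)
open import Relation.Binary.Structures using (IsEquivalence)
import Relation.Binary.Reasoning.Setoid as SetoidReasoning
open import Defs

module BiCCCProperties {o ℓ e} {C : Category o ℓ e} (S : StableBiCCC C) where
  open Category C
  open StableBiCCC S

  module Equiv {X Y} = IsEquivalence (≈-equiv {X} {Y})

  hom-setoid : Obj → Obj → Setoid ℓ e
  hom-setoid X Y = record { Carrier = Hom X Y ; _≈_ = _≈_ ; isEquivalence = ≈-equiv }

  module HomReasoning {X Y} = SetoidReasoning (hom-setoid X Y)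
  open HomReasoning public

  infixr 4 _⟩∘⟨_
  _⟩∘⟨_ : ∀ {X Y Z} {f f' : Hom Y Z} {g g' : Hom X Y} → f ≈ f' → g ≈ g' → f ∘ g ≈ f' ∘ g'
  _⟩∘⟨_ = ∘-cong

  refl⟩∘⟨_ : ∀ {X Y Z} {f : Hom Y Z} {g g' : Hom X Y} → g ≈ g' → f ∘ g ≈ f ∘ g'
  refl⟩∘⟨ p = ∘-cong Equiv.refl p

  _⟩∘⟨refl : ∀ {X Y Z} {f f' : Hom Y Z} {g : Hom X Y} → f ≈ f' → f ∘ g ≈ f' ∘ g
  p ⟩∘⟨refl = ∘-cong p Equiv.refl

  sym-assoc : ∀ {W X Y Z} {f : Hom Y Z} {g : Hom X Y} {h : Hom W X} → f ∘ g ∘ h ≈ (f ∘ g) ∘ h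
  sym-assoc = Equiv.sym assoc

  assoc² : ∀ {V W X Y Z} {f : Hom Y Z} {g : Hom X Y} {h : Hom W X} {i : Hom V W} →
           (f ∘ g ∘ h) ∘ i ≈ f ∘ g ∘ h ∘ i
  assoc² = Equiv.trans assoc (refl⟩∘⟨ assoc)

  pullˡ : ∀ {W X Y Z} {a : Hom Y Z} {b : Hom X Y} {c : Hom X Z} {f : Hom W X} →
          a ∘ b ≈ c → a ∘ b ∘ f ≈ c ∘ f
  pullˡ p = Equiv.trans sym-assoc (p ⟩∘⟨refl)

  pushˡ : ∀ {W X Y Z} {a : Hom Y Z} {b : Hom X Y} {c : Hom X Z} {f : Hom W X} →
          c ≈ a ∘ b → c ∘ f ≈ a ∘ b ∘ f
  pushˡ p = Equiv.trans (p ⟩∘⟨refl) assoc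

  pullʳ : ∀ {W X Y Z} {a : Hom Y Z} {b : Hom X Y} {c : Hom W Y} {f : Hom W X} →
          b ∘ f ≈ c → (a ∘ b) ∘ f ≈ a ∘ c
  pullʳ p = Equiv.trans assoc (refl⟩∘⟨ p)

  cancelˡ : ∀ {W X Y} {a : Hom Y X} {b : Hom X Y} {f : Hom W X} → a ∘ b ≈ id → a ∘ b ∘ f ≈ f
  cancelˡ p = Equiv.trans (pullˡ p) identityˡ

  extendʳ : ∀ {V X Y Y' Z} {a : Hom Y Z} {b : Hom X Y} {a' : Hom Y' Z} {b' : Hom X Y'} {f : Hom V X} →
            a ∘ b ≈ a' ∘ b' → a ∘ b ∘ f ≈ a' ∘ b' ∘ f
  extendʳ p = Equiv.trans (pullˡ p) assoc

  ⟨⟩-cong : ∀ {Z X Y} {f f' : Hom Z X} {g g' : Hom Z Y} → f ≈ f' → g ≈ g' → ⟨ f , g ⟩ ≈ ⟨ f' , g' ⟩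
  ⟨⟩-cong p q = ⟨⟩-unique _ (Equiv.trans π₁-β p) (Equiv.trans π₂-β q)

  ⟨⟩∘ : ∀ {W Z X Y} {f : Hom Z X} {g : Hom Z Y} {h : Hom W Z} → ⟨ f , g ⟩ ∘ h ≈ ⟨ f ∘ h , g ∘ h ⟩
  ⟨⟩∘ = ⟨⟩-unique _ (pullˡ π₁-β) (pullˡ π₂-β)

  ⟨⟩-η : ∀ {X Y} → ⟨ π₁ , π₂ ⟩ ≈ id {X ⊗ Y}
  ⟨⟩-η = Equiv.sym (⟨⟩-unique id identityʳ identityʳ)

  ⊗₁∘⟨⟩ : ∀ {W X Y X' Y'} {f : Hom X X'} {g : Hom Y Y'} {a : Hom W X} {b : Hom W Y} →
          (f ⊗₁ g) ∘ ⟨ a , b ⟩ ≈ ⟨ f ∘ a , g ∘ b ⟩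
  ⊗₁∘⟨⟩ = Equiv.trans ⟨⟩∘ (⟨⟩-cong (pullʳ π₁-β) (pullʳ π₂-β))

  swap∘⟨⟩ : ∀ {W X Y} {a : Hom W X} {b : Hom W Y} → swap ∘ ⟨ a , b ⟩ ≈ ⟨ b , a ⟩
  swap∘⟨⟩ = Equiv.trans ⟨⟩∘ (⟨⟩-cong π₂-β π₁-β)

  swap∘swap : ∀ {X Y} → swap ∘ swap ≈ id {X ⊗ Y}
  swap∘swap = Equiv.trans swap∘⟨⟩ ⟨⟩-η

  !-unique₂ : ∀ {X} {f g : Hom X 𝟙} → f ≈ g
  !-unique₂ = Equiv.trans (!-unique _) (Equiv.sym (!-unique _))

  infixr 6 _⊕₁_
  _⊕₁_ : ∀ {X Y X' Y'} → Hom X X' → Hom Y Y' → Hom (X ⊕ Y) (X' ⊕ Y')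
  f ⊕₁ g = [ ι₁ ∘ f , ι₂ ∘ g ]

  []-cong : ∀ {X Y Z} {f f' : Hom X Z} {g g' : Hom Y Z} → f ≈ f' → g ≈ g' → [ f , g ] ≈ [ f' , g' ]
  []-cong p q = []-unique _ (Equiv.trans ι₁-β p) (Equiv.trans ι₂-β q)

  ⊕₁-cong : ∀ {X Y X' Y'} {f f' : Hom X X'} {g g' : Hom Y Y'} → f ≈ f' → g ≈ g' → f ⊕₁ g ≈ f' ⊕₁ g'
  ⊕₁-cong p q = []-cong (refl⟩∘⟨ p) (refl⟩∘⟨ q)

  ∘[] : ∀ {X Y Z W} {f : Hom X Z} {g : Hom Y Z} {h : Hom Z W} → h ∘ [ f , g ] ≈ [ h ∘ f , h ∘ g ]
  ∘[] = []-unique _ (Equiv.trans assoc (refl⟩∘⟨ ι₁-β)) (Equiv.trans assoc (refl⟩∘⟨ ι₂-β))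

  []-η : ∀ {X Y} → [ ι₁ , ι₂ ] ≈ id {X ⊕ Y}
  []-η = Equiv.sym ([]-unique id identityˡ identityˡ)

  id⊕₁id : ∀ {X Y} → id {X} ⊕₁ id {Y} ≈ id
  id⊕₁id = Equiv.trans ([]-cong identityʳ identityʳ) []-η

  []-ext : ∀ {X Y Z} {f g : Hom (X ⊕ Y) Z} → f ∘ ι₁ ≈ g ∘ ι₁ → f ∘ ι₂ ≈ g ∘ ι₂ → f ≈ g
  []-ext p q = Equiv.trans ([]-unique _ p q) (Equiv.sym ([]-unique _ Equiv.refl Equiv.refl))

  []∘⊕₁ : ∀ {X Y X' Y' Z} {f : Hom X' Z} {g : Hom Y' Z} {h : Hom X X'} {k : Hom Y Y'} →
          [ f , g ] ∘ (h ⊕₁ k) ≈ [ f ∘ h , g ∘ k ]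
  []∘⊕₁ = Equiv.trans ∘[] ([]-cong (pullˡ ι₁-β) (pullˡ ι₂-β))

  ⊕₁∘⊕₁ : ∀ {X Y X' Y' X'' Y''} {f : Hom X' X''} {g : Hom Y' Y''} {h : Hom X X'} {k : Hom Y Y'} →
          (f ⊕₁ g) ∘ (h ⊕₁ k) ≈ (f ∘ h) ⊕₁ (g ∘ k)
  ⊕₁∘⊕₁ = Equiv.trans []∘⊕₁ ([]-cong assoc assoc)

  ¡-unique₂ : ∀ {X} {f g : Hom 𝟘 X} → f ≈ g
  ¡-unique₂ = Equiv.trans (¡-unique _) (Equiv.sym (¡-unique _))

  curry-β : ∀ {Z W X Y} {f : Hom (Z ⊗ Y) X} {g : Hom W Z} {x : Hom W Y} →
            ev ∘ ⟨ curry f ∘ g , x ⟩ ≈ f ∘ ⟨ g , x ⟩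
  curry-β {f = f} {g} {x} = begin
    ev ∘ ⟨ curry f ∘ g , x ⟩                      ≈⟨ refl⟩∘⟨ Equiv.trans ⊗₁∘⟨⟩ (⟨⟩-cong Equiv.refl identityˡ) ⟨
    ev ∘ (⟨ curry f ∘ π₁ , id ∘ π₂ ⟩ ∘ ⟨ g , x ⟩) ≈⟨ pullˡ ev-β ⟩
    f ∘ ⟨ g , x ⟩                                 ∎

  curry-cong : ∀ {Z X Y} {f f' : Hom (Z ⊗ Y) X} → f ≈ f' → curry f ≈ curry f'
  curry-cong p = curry-unique _ (Equiv.trans ev-β p)

  curry-∘ : ∀ {Z W X Y} {f : Hom (Z ⊗ Y) X} {g : Hom W Z} → curry f ∘ g ≈ curry (f ∘ (g ⊗₁ id))
  curry-∘ = curry-unique _ (Equiv.trans (refl⟩∘⟨ ⟨⟩-cong assoc Equiv.refl) curry-β)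

  curry-injective : ∀ {Z X Y} {f f' : Hom (Z ⊗ Y) X} → curry f ≈ curry f' → f ≈ f'
  curry-injective p =
    Equiv.trans (Equiv.sym ev-β) (Equiv.trans (refl⟩∘⟨ ⟨⟩-cong (p ⟩∘⟨refl) Equiv.refl) ev-β)

  -- Maps out of 𝟘 ⊗ Z curry to maps out of 𝟘, so they all agree.
  𝟘-strict : ∀ {Z X} (h : Hom Z 𝟘) {f g : Hom Z X} → f ≈ g
  𝟘-strict h {f} {g} = begin
    f                   ≈⟨ Equiv.trans (refl⟩∘⟨ π₂-β) identityʳ ⟨
    f ∘ π₂ ∘ ⟨ h , id ⟩ ≈⟨ extendʳ (curry-injective ¡-unique₂) ⟩
    g ∘ π₂ ∘ ⟨ h , id ⟩ ≈⟨ Equiv.trans (refl⟩∘⟨ π₂-β) identityʳ ⟩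
    g                   ∎

  ⊗₁-cong : ∀ {X Y X' Y'} {f f' : Hom X X'} {g g' : Hom Y Y'} → f ≈ f' → g ≈ g' → f ⊗₁ g ≈ f' ⊗₁ g'
  ⊗₁-cong p q = ⟨⟩-cong (p ⟩∘⟨refl) (q ⟩∘⟨refl)

  ⊗₁∘⊗₁ : ∀ {X Y X' Y' X'' Y''} {f : Hom X' X''} {g : Hom Y' Y''} {h : Hom X X'} {k : Hom Y Y'} →
          (f ⊗₁ g) ∘ (h ⊗₁ k) ≈ (f ∘ h) ⊗₁ (g ∘ k)
  ⊗₁∘⊗₁ = Equiv.trans ⊗₁∘⟨⟩ (⟨⟩-cong sym-assoc sym-assoc)

  id⊗₁id : ∀ {X Y} → id {X} ⊗₁ id {Y} ≈ id
  id⊗₁id = Equiv.trans (⟨⟩-cong identityˡ identityˡ) ⟨⟩-η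

  ⟨⟩-factor : ∀ {W X Y Y'} {e : Hom W X} {f : Hom Y Y'} {w : Hom W Y} →
              ⟨ e , f ∘ w ⟩ ≈ (e ⊗₁ f) ∘ ⟨ id , w ⟩
  ⟨⟩-factor = Equiv.sym (Equiv.trans ⊗₁∘⟨⟩ (⟨⟩-cong identityʳ Equiv.refl))

  ⊗₁∘ : ∀ {W X Y X' Y'} {f : Hom X X'} {g : Hom Y Y'} {x : Hom W (X ⊗ Y)} →
        (f ⊗₁ g) ∘ x ≈ ⟨ f ∘ π₁ ∘ x , g ∘ π₂ ∘ x ⟩
  ⊗₁∘ = Equiv.trans ⟨⟩∘ (⟨⟩-cong assoc assoc)

  ⊗₁∘-components : ∀ {W X Y X' Y' X'' Y''} {f : Hom X X''} {g : Hom Y Y''} {f' : Hom X' X''} {g' : Hom Y' Y''}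
                     {x : Hom W (X ⊗ Y)} {y : Hom W (X' ⊗ Y')} →
                   (f ⊗₁ g) ∘ x ≈ (f' ⊗₁ g') ∘ y → (f ∘ π₁ ∘ x ≈ f' ∘ π₁ ∘ y) × (g ∘ π₂ ∘ x ≈ g' ∘ π₂ ∘ y)
  ⊗₁∘-components p = let p' = Equiv.trans (Equiv.sym ⊗₁∘) (Equiv.trans p ⊗₁∘) in
    Equiv.trans (Equiv.sym π₁-β) (Equiv.trans (refl⟩∘⟨ p') π₁-β) ,
    Equiv.trans (Equiv.sym π₂-β) (Equiv.trans (refl⟩∘⟨ p') π₂-β)

  swap∘⊗₁ : ∀ {X Y X' Y'} {f : Hom X X'} {g : Hom Y Y'} → swap ∘ (f ⊗₁ g) ≈ (g ⊗₁ f) ∘ swap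
  swap∘⊗₁ = Equiv.trans swap∘⟨⟩ (Equiv.sym ⊗₁∘⟨⟩)

  dist∘⟨⟩ : ∀ {W X Y Z} {a : Hom W X} {x : Hom W (Y ⊕ Z)} →
            dist ∘ ⟨ a , x ⟩ ≈ ev ∘ ⟨ [ curry (ι₁ ∘ swap) , curry (ι₂ ∘ swap) ] ∘ x , a ⟩
  dist∘⟨⟩ = Equiv.trans (pullʳ swap∘⟨⟩) (Equiv.trans (pullʳ ⊗₁∘⟨⟩) (refl⟩∘⟨ ⟨⟩-cong Equiv.refl identityˡ))

  dist∘⊗₁ι₁ : ∀ {X X' Y Y' Z} {f : Hom X' X} {g : Hom Y' Y} →
              dist {X} {Y} {Z} ∘ (f ⊗₁ (ι₁ ∘ g)) ≈ ι₁ ∘ (f ⊗₁ g)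
  dist∘⊗₁ι₁ {f = f} {g} = begin
    dist ∘ ⟨ f ∘ π₁ , (ι₁ ∘ g) ∘ π₂ ⟩                         ≈⟨ Equiv.trans (refl⟩∘⟨ ⟨⟩-cong Equiv.refl assoc) dist∘⟨⟩ ⟩
    ev ∘ ⟨ [ curry (ι₁ ∘ swap) , _ ] ∘ ι₁ ∘ g ∘ π₂ , f ∘ π₁ ⟩ ≈⟨ refl⟩∘⟨ ⟨⟩-cong (pullˡ ι₁-β) Equiv.refl ⟩
    ev ∘ ⟨ curry (ι₁ ∘ swap) ∘ g ∘ π₂ , f ∘ π₁ ⟩              ≈⟨ curry-β ⟩
    (ι₁ ∘ swap) ∘ ⟨ g ∘ π₂ , f ∘ π₁ ⟩                         ≈⟨ pullʳ swap∘⟨⟩ ⟩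
    ι₁ ∘ (f ⊗₁ g)                                             ∎

  dist∘⊗₁ι₂ : ∀ {X X' Y Z Z'} {f : Hom X' X} {g : Hom Z' Z} →
              dist {X} {Y} {Z} ∘ (f ⊗₁ (ι₂ ∘ g)) ≈ ι₂ ∘ (f ⊗₁ g)
  dist∘⊗₁ι₂ {f = f} {g} = begin
    dist ∘ ⟨ f ∘ π₁ , (ι₂ ∘ g) ∘ π₂ ⟩                         ≈⟨ Equiv.trans (refl⟩∘⟨ ⟨⟩-cong Equiv.refl assoc) dist∘⟨⟩ ⟩
    ev ∘ ⟨ [ _ , curry (ι₂ ∘ swap) ] ∘ ι₂ ∘ g ∘ π₂ , f ∘ π₁ ⟩ ≈⟨ refl⟩∘⟨ ⟨⟩-cong (pullˡ ι₂-β) Equiv.refl ⟩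
    ev ∘ ⟨ curry (ι₂ ∘ swap) ∘ g ∘ π₂ , f ∘ π₁ ⟩              ≈⟨ curry-β ⟩
    (ι₂ ∘ swap) ∘ ⟨ g ∘ π₂ , f ∘ π₁ ⟩                         ≈⟨ pullʳ swap∘⟨⟩ ⟩
    ι₂ ∘ (f ⊗₁ g)                                             ∎

  dist∘id⊗₁ι₁ : ∀ {X Y Z} → dist {X} {Y} {Z} ∘ (id ⊗₁ ι₁) ≈ ι₁
  dist∘id⊗₁ι₁ = begin
    dist ∘ (id ⊗₁ ι₁)        ≈⟨ refl⟩∘⟨ ⊗₁-cong Equiv.refl identityʳ ⟨
    dist ∘ (id ⊗₁ (ι₁ ∘ id)) ≈⟨ dist∘⊗₁ι₁ ⟩
    ι₁ ∘ (id ⊗₁ id)          ≈⟨ Equiv.trans (refl⟩∘⟨ id⊗₁id) identityʳ ⟩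
    ι₁                       ∎

  dist∘id⊗₁ι₂ : ∀ {X Y Z} → dist {X} {Y} {Z} ∘ (id ⊗₁ ι₂) ≈ ι₂
  dist∘id⊗₁ι₂ = begin
    dist ∘ (id ⊗₁ ι₂)        ≈⟨ refl⟩∘⟨ ⊗₁-cong Equiv.refl identityʳ ⟨
    dist ∘ (id ⊗₁ (ι₂ ∘ id)) ≈⟨ dist∘⊗₁ι₂ ⟩
    ι₂ ∘ (id ⊗₁ id)          ≈⟨ Equiv.trans (refl⟩∘⟨ id⊗₁id) identityʳ ⟩
    ι₂                       ∎

  -- Through swap and currying this is the universal property of Y₁ ⊕ Y₂.
  ⊗⊕-ext : ∀ {X Y₁ Y₂ R} {F F' : Hom (X ⊗ (Y₁ ⊕ Y₂)) R} →
           F ∘ (id ⊗₁ ι₁) ≈ F' ∘ (id ⊗₁ ι₁) → F ∘ (id ⊗₁ ι₂) ≈ F' ∘ (id ⊗₁ ι₂) → F ≈ F'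
  ⊗⊕-ext {X} {Y₁} {Y₂} {R} {F} {F'} p₁ p₂ = begin
    F                ≈⟨ Equiv.trans (refl⟩∘⟨ swap∘swap) identityʳ ⟨
    F ∘ swap ∘ swap  ≈⟨ extendʳ (curry-injective ([]-ext (restrict p₁) (restrict p₂))) ⟩
    F' ∘ swap ∘ swap ≈⟨ Equiv.trans (refl⟩∘⟨ swap∘swap) identityʳ ⟩
    F'               ∎
    where
    curry∘ : ∀ {Y} (G : Hom _ R) (i : Hom Y (Y₁ ⊕ Y₂)) → curry (G ∘ swap) ∘ i ≈ curry ((G ∘ (id ⊗₁ i)) ∘ swap)
    curry∘ G i = Equiv.trans curry-∘ (curry-cong (Equiv.trans (pullʳ swap∘⊗₁) sym-assoc))
    restrict : ∀ {Y} {i : Hom Y (Y₁ ⊕ Y₂)} → F ∘ (id ⊗₁ i) ≈ F' ∘ (id ⊗₁ i) →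
               curry (F ∘ swap) ∘ i ≈ curry (F' ∘ swap) ∘ i
    restrict {i = i} p = Equiv.trans (curry∘ F i)
      (Equiv.trans (curry-cong (p ⟩∘⟨refl)) (Equiv.sym (curry∘ F' i)))

  dist-natural : ∀ {X X' Y Y' Z Z'} {f : Hom X X'} {g : Hom Y Y'} {h : Hom Z Z'} →
                 dist ∘ (f ⊗₁ (g ⊕₁ h)) ≈ ((f ⊗₁ g) ⊕₁ (f ⊗₁ h)) ∘ dist
  dist-natural {f = f} {g} {h} = ⊗⊕-ext
    (begin
      (dist ∘ (f ⊗₁ (g ⊕₁ h))) ∘ (id ⊗₁ ι₁)        ≈⟨ pullʳ (Equiv.trans ⊗₁∘⊗₁ (⊗₁-cong identityʳ ι₁-β)) ⟩
      dist ∘ (f ⊗₁ (ι₁ ∘ g))                       ≈⟨ dist∘⊗₁ι₁ ⟩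
      ι₁ ∘ (f ⊗₁ g)                                ≈⟨ Equiv.trans (refl⟩∘⟨ dist∘id⊗₁ι₁) ι₁-β ⟨
      ((f ⊗₁ g) ⊕₁ (f ⊗₁ h)) ∘ dist ∘ (id ⊗₁ ι₁)   ≈⟨ sym-assoc ⟩
      (((f ⊗₁ g) ⊕₁ (f ⊗₁ h)) ∘ dist) ∘ (id ⊗₁ ι₁) ∎)
    (begin
      (dist ∘ (f ⊗₁ (g ⊕₁ h))) ∘ (id ⊗₁ ι₂)        ≈⟨ pullʳ (Equiv.trans ⊗₁∘⊗₁ (⊗₁-cong identityʳ ι₂-β)) ⟩
      dist ∘ (f ⊗₁ (ι₂ ∘ h))                       ≈⟨ dist∘⊗₁ι₂ ⟩
      ι₂ ∘ (f ⊗₁ h)                                ≈⟨ Equiv.trans (refl⟩∘⟨ dist∘id⊗₁ι₂) ι₂-β ⟨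
      ((f ⊗₁ g) ⊕₁ (f ⊗₁ h)) ∘ dist ∘ (id ⊗₁ ι₂)   ≈⟨ sym-assoc ⟩
      (((f ⊗₁ g) ⊕₁ (f ⊗₁ h)) ∘ dist) ∘ (id ⊗₁ ι₂) ∎)

  []∘dist∘⟨,⊕₁∘⟩ : ∀ {W G W₁ W₂ X₁ X₂ R} {n₁ : Hom (G ⊗ X₁) R} {n₂ : Hom (G ⊗ X₂) R} {g : Hom W G}
                     {a₁ : Hom W₁ X₁} {a₂ : Hom W₂ X₂} {u : Hom W (W₁ ⊕ W₂)} →
                   ([ n₁ , n₂ ] ∘ dist) ∘ ⟨ g , (a₁ ⊕₁ a₂) ∘ u ⟩ ≈
                   [ n₁ ∘ (g ⊗₁ a₁) , n₂ ∘ (g ⊗₁ a₂) ] ∘ dist ∘ ⟨ id , u ⟩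
  []∘dist∘⟨,⊕₁∘⟩ {n₁ = n₁} {n₂} {g} {a₁} {a₂} {u} = begin
    ([ n₁ , n₂ ] ∘ dist) ∘ ⟨ g , (a₁ ⊕₁ a₂) ∘ u ⟩              ≈⟨ pullʳ (refl⟩∘⟨ ⟨⟩-factor) ⟩
    [ n₁ , n₂ ] ∘ dist ∘ (g ⊗₁ (a₁ ⊕₁ a₂)) ∘ ⟨ id , u ⟩        ≈⟨ refl⟩∘⟨ extendʳ dist-natural ⟩
    [ n₁ , n₂ ] ∘ ((g ⊗₁ a₁) ⊕₁ (g ⊗₁ a₂)) ∘ dist ∘ ⟨ id , u ⟩ ≈⟨ pullˡ []∘⊕₁ ⟩
    [ n₁ ∘ (g ⊗₁ a₁) , n₂ ∘ (g ⊗₁ a₂) ] ∘ dist ∘ ⟨ id , u ⟩    ∎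

module StrongMonadProperties {o ℓ e} {C : Category o ℓ e} (S : StableBiCCC C) (M : StrongMonad S) where
  open Category C
  open StableBiCCC S
  open BiCCCProperties S
  open StrongMonad M

  -- Moggi's  let x ⇐ c in k (e , x)
  strongBind : ∀ {Z E X Y} → Hom (E ⊗ X) (T₀ Y) → Hom Z E → Hom Z (T₀ X) → Hom Z (T₀ Y)
  strongBind k e c = μ ∘ T₁ k ∘ st ∘ ⟨ e , c ⟩

  T₁[]∘[T₁ι₁,T₁ι₂] : ∀ {W₁ W₂ X₁ X₂ Y} {f : Hom X₁ Y} {g : Hom X₂ Y}
                       {a : Hom W₁ (T₀ X₁)} {b : Hom W₂ (T₀ X₂)} →
                     T₁ [ f , g ] ∘ [ T₁ ι₁ ∘ a , T₁ ι₂ ∘ b ] ≈ [ T₁ f ∘ a , T₁ g ∘ b ]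
  T₁[]∘[T₁ι₁,T₁ι₂] = Equiv.trans ∘[] ([]-cong (pullˡ (Equiv.trans (Equiv.sym T₁-∘) (T₁-cong ι₁-β)))
                                               (pullˡ (Equiv.trans (Equiv.sym T₁-∘) (T₁-cong ι₂-β))))

  st'∘⟨⟩ : ∀ {Z X Y} {a : Hom Z (T₀ X)} {b : Hom Z Y} → st' ∘ ⟨ a , b ⟩ ≈ T₁ swap ∘ st ∘ ⟨ b , a ⟩
  st'∘⟨⟩ = pullʳ (pullʳ swap∘⟨⟩)

  pair-as-bind : ∀ {Z G X Y} {m : Hom G (T₀ X)} {n : Hom G (T₀ Y)} {γ : Hom Z G} →
                 (μ ∘ T₁ st ∘ st' ∘ ⟨ m , n ⟩) ∘ γ ≈ strongBind (st ∘ swap) (n ∘ γ) (m ∘ γ)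
  pair-as-bind {m = m} {n} {γ} = begin
    (μ ∘ T₁ st ∘ st' ∘ ⟨ m , n ⟩) ∘ γ            ≈⟨ assoc² ⟩
    μ ∘ T₁ st ∘ (st' ∘ ⟨ m , n ⟩) ∘ γ            ≈⟨ refl⟩∘⟨ refl⟩∘⟨ Equiv.trans (pullʳ ⟨⟩∘) st'∘⟨⟩ ⟩
    μ ∘ T₁ st ∘ T₁ swap ∘ st ∘ ⟨ n ∘ γ , m ∘ γ ⟩ ≈⟨ refl⟩∘⟨ pullˡ (Equiv.sym T₁-∘) ⟩
    strongBind (st ∘ swap) (n ∘ γ) (m ∘ γ)       ∎

  app-as-bind : ∀ {Z G X Y} {m : Hom G (T₀ (Exp (T₀ Y) X))} {n : Hom G (T₀ X)} {γ : Hom Z G} →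
                (μ ∘ T₁ μ ∘ T₁ (T₁ ev) ∘ T₁ st ∘ st' ∘ ⟨ m , n ⟩) ∘ γ ≈
                strongBind ((μ ∘ T₁ ev ∘ st) ∘ swap) (n ∘ γ) (m ∘ γ)
  app-as-bind {m = m} {n} {γ} = begin
    (μ ∘ T₁ μ ∘ T₁ (T₁ ev) ∘ T₁ st ∘ st' ∘ ⟨ m , n ⟩) ∘ γ      ≈⟨ (refl⟩∘⟨ fold) ⟩∘⟨refl ⟩
    (μ ∘ T₁ (μ ∘ T₁ ev ∘ st) ∘ st' ∘ ⟨ m , n ⟩) ∘ γ            ≈⟨ assoc² ⟩
    μ ∘ T₁ (μ ∘ T₁ ev ∘ st) ∘ (st' ∘ ⟨ m , n ⟩) ∘ γ            ≈⟨ refl⟩∘⟨ refl⟩∘⟨ Equiv.trans (pullʳ ⟨⟩∘) st'∘⟨⟩ ⟩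
    μ ∘ T₁ (μ ∘ T₁ ev ∘ st) ∘ T₁ swap ∘ st ∘ ⟨ n ∘ γ , m ∘ γ ⟩ ≈⟨ refl⟩∘⟨ pullˡ (Equiv.sym T₁-∘) ⟩
    strongBind ((μ ∘ T₁ ev ∘ st) ∘ swap) (n ∘ γ) (m ∘ γ)       ∎
    where
    fold : ∀ {W} {x : Hom W _} → T₁ μ ∘ T₁ (T₁ ev) ∘ T₁ st ∘ x ≈ T₁ (μ ∘ T₁ ev ∘ st) ∘ x
    fold = Equiv.trans (refl⟩∘⟨ pullˡ (Equiv.sym T₁-∘)) (pullˡ (Equiv.sym T₁-∘))

  case-as-bind : ∀ {Z G X R} {k : Hom (G ⊗ X) (T₀ R)} {m : Hom G (T₀ X)} {γ : Hom Z G} →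
                 (μ ∘ T₁ k ∘ st ∘ ⟨ id , m ⟩) ∘ γ ≈ strongBind k γ (m ∘ γ)
  case-as-bind = Equiv.trans assoc² (refl⟩∘⟨ refl⟩∘⟨ pullʳ (Equiv.trans ⟨⟩∘ (⟨⟩-cong identityˡ Equiv.refl)))

module GroundIso {o ℓ e} {C : Category o ℓ e} {S : StableBiCCC C} (Sg : Signature)
                 {M : StrongMonad S} (𝒜 : Semantics.Structure S Sg M) where
  open Category C
  open StableBiCCC S
  open BiCCCProperties S
  open Signature Sg
  open Semantics S Sg
  open Structure 𝒜
  open Interp 𝒜

  private
    ≡⇒Hom-⊗ : ∀ {X X' Y Y'} (p : X ≡ X') (q : Y ≡ Y') → ≡⇒Hom (≡.cong₂ _⊗_ p q) ≈ ≡⇒Hom p ⊗₁ ≡⇒Hom q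
    ≡⇒Hom-⊗ refl refl = Equiv.sym id⊗₁id

    ≡⇒Hom-⊕ : ∀ {X X' Y Y'} (p : X ≡ X') (q : Y ≡ Y') → ≡⇒Hom (≡.cong₂ _⊕_ p q) ≈ ≡⇒Hom p ⊕₁ ≡⇒Hom q
    ≡⇒Hom-⊕ refl refl = Equiv.sym id⊕₁id

    ≡⇒Hom∘≡⇒Hom-sym : ∀ {X X'} (p : X ≡ X') → ≡⇒Hom p ∘ ≡⇒Hom (≡.sym p) ≈ id
    ≡⇒Hom∘≡⇒Hom-sym refl = identityˡ

    ≡⇒Hom-sym∘≡⇒Hom : ∀ {X X'} (p : X ≡ X') → ≡⇒Hom (≡.sym p) ∘ ≡⇒Hom p ≈ id
    ≡⇒Hom-sym∘≡⇒Hom refl = identityˡ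

  to : (g : GTy B) → Hom ⟦ ⌜ g ⌝ ⟧ty (⟦ g ⟧g A)
  to g = ≡⇒Hom (ground≡ g)

  from : (g : GTy B) → Hom (⟦ g ⟧g A) ⟦ ⌜ g ⌝ ⟧ty
  from g = ≡⇒Hom (≡.sym (ground≡ g))

  toᶜ : (Γ : GCtx B) → Hom ⟦ ⌜ Γ ⌝c ⟧ctx (⟦ Γ ⟧gc A)
  toᶜ Γ = ≡⇒Hom (groundCtx≡ Γ)

  fromᶜ : (Γ : GCtx B) → Hom (⟦ Γ ⟧gc A) ⟦ ⌜ Γ ⌝c ⟧ctx
  fromᶜ Γ = ≡⇒Hom (≡.sym (groundCtx≡ Γ))

  to∘from : ∀ g → to g ∘ from g ≈ id
  to∘from g = ≡⇒Hom∘≡⇒Hom-sym (ground≡ g)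

  from∘to : ∀ g → from g ∘ to g ≈ id
  from∘to g = ≡⇒Hom-sym∘≡⇒Hom (ground≡ g)

  toᶜ∘fromᶜ : ∀ Γ → toᶜ Γ ∘ fromᶜ Γ ≈ id
  toᶜ∘fromᶜ Γ = ≡⇒Hom∘≡⇒Hom-sym (groundCtx≡ Γ)

  to-×ᵍ : ∀ g h → to (g ×ᵍ h) ≈ to g ⊗₁ to h
  to-×ᵍ g h = ≡⇒Hom-⊗ (ground≡ g) (ground≡ h)

  to-+ᵍ : ∀ g h → to (g +ᵍ h) ≈ to g ⊕₁ to h
  to-+ᵍ g h = ≡⇒Hom-⊕ (ground≡ g) (ground≡ h)

  [from⊕₁from]∘to : ∀ g h → (from g ⊕₁ from h) ∘ to (g +ᵍ h) ≈ id
  [from⊕₁from]∘to g h = begin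
    (from g ⊕₁ from h) ∘ to (g +ᵍ h)    ≈⟨ refl⟩∘⟨ to-+ᵍ g h ⟩
    (from g ⊕₁ from h) ∘ (to g ⊕₁ to h) ≈⟨ ⊕₁∘⊕₁ ⟩
    (from g ∘ to g) ⊕₁ (from h ∘ to h)  ≈⟨ Equiv.trans (⊕₁-cong (from∘to g) (from∘to h)) id⊕₁id ⟩
    id                                  ∎

  toᶜ-▸ : ∀ Γ g → toᶜ (Γ ▸ g) ≈ toᶜ Γ ⊗₁ to g
  toᶜ-▸ Γ g = ≡⇒Hom-⊗ (groundCtx≡ Γ) (ground≡ g)

module LogicalRelation {o ℓ e} {C : Category o ℓ e} (S : StableBiCCC C) (Sg : Signature)
  {T U : StrongMonad S} (φ : MonadMorphism S T U) (𝒜 : Semantics.Structure S Sg T) where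
  open Category C
  open StableBiCCC S
  open BiCCCProperties S
  open Signature Sg
  open Semantics S Sg using (_⊢_; ⟦_⟧g; pushStructure)
  open Semantics.Structure 𝒜
  open MonadMorphism φ
  open Terms Sg hiding (_⊢_)
  module T = StrongMonad T
  module U = StrongMonad U
  module IT = Semantics.Interp S Sg 𝒜
  module IU = Semantics.Interp S Sg (pushStructure φ 𝒜)
  module GT = GroundIso Sg 𝒜
  module GU = GroundIso Sg (pushStructure φ 𝒜)

  L : Level
  L = o ⊔ ℓ ⊔ e

  GRel : Obj → Obj → Set (Level.suc L)
  GRel X Y = ∀ {W} → Hom W X → Hom W Y → Set L

  Reindexable : ∀ {X Y} → GRel X Y → Set L
  Reindexable R = ∀ {W W'} (h : Hom W' W) {p r} → R p r → R (p ∘ h) (r ∘ h)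

  CopairClosed : ∀ {X Y} → GRel X Y → Set L
  CopairClosed R = ∀ {W₁ W₂} {p₁ : Hom W₁ _} {r₁ : Hom W₁ _} {p₂ : Hom W₂ _} {r₂ : Hom W₂ _} →
                   R p₁ r₁ → R p₂ r₂ → R [ p₁ , p₂ ] [ r₁ , r₂ ]

  record CompRel {X Y} (R : GRel X Y) {Z} (c : Hom Z (T.T₀ X)) (d : Hom Z (U.T₀ Y)) : Set L where
    constructor span
    field
      W : Obj
      w : Hom Z (T.T₀ W)
      p : Hom W X
      r : Hom W Y
      rel : R p r
      c-factors : c ≈ T.T₁ p ∘ w
      d-factors : d ≈ U.T₁ r ∘ α ∘ w

  record SumRel {X₁ X₂ Y₁ Y₂} (R₁ : GRel X₁ Y₁) (R₂ : GRel X₂ Y₂) {Z}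
                (x : Hom Z (X₁ ⊕ X₂)) (y : Hom Z (Y₁ ⊕ Y₂)) : Set L where
    constructor split
    field
      W₁ W₂ : Obj
      u : Hom Z (W₁ ⊕ W₂)
      p₁ : Hom W₁ X₁
      r₁ : Hom W₁ Y₁
      p₂ : Hom W₂ X₂
      r₂ : Hom W₂ Y₂
      rel₁ : R₁ p₁ r₁
      rel₂ : R₂ p₂ r₂
      x-factors : x ≈ (p₁ ⊕₁ p₂) ∘ u
      y-factors : y ≈ (r₁ ⊕₁ r₂) ∘ u

  record WithEnv {Z E E' X Y} (e : Hom Z E) (e' : Hom Z E') (R : GRel X Y) {W}
                 (x : Hom W (E ⊗ X)) (y : Hom W (E' ⊗ Y)) : Set L where
    constructor at
    field
      stage : Hom W Z
      p : Hom W X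
      r : Hom W Y
      rel : R p r
      x-factors : x ≈ ⟨ e ∘ stage , p ⟩
      y-factors : y ≈ ⟨ e' ∘ stage , r ⟩

  module _ {X₁ X₂ Y₁ Y₂} {R₁ : GRel X₁ Y₁} {R₂ : GRel X₂ Y₂} where

    SumRel-resp : ∀ {Z} {x x' : Hom Z (X₁ ⊕ X₂)} {y y' : Hom Z (Y₁ ⊕ Y₂)} →
                  x ≈ x' → y ≈ y' → SumRel R₁ R₂ x y → SumRel R₁ R₂ x' y'
    SumRel-resp px py (split W₁ W₂ u p₁ r₁ p₂ r₂ rel₁ rel₂ ex ey) =
      split W₁ W₂ u p₁ r₁ p₂ r₂ rel₁ rel₂ (Equiv.trans (Equiv.sym px) ex) (Equiv.trans (Equiv.sym py) ey)

    SumRel-reindex : Reindexable (SumRel R₁ R₂)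
    SumRel-reindex h (split W₁ W₂ u p₁ r₁ p₂ r₂ rel₁ rel₂ ex ey) =
      split W₁ W₂ (u ∘ h) p₁ r₁ p₂ r₂ rel₁ rel₂ (Equiv.trans (ex ⟩∘⟨refl) assoc) (Equiv.trans (ey ⟩∘⟨refl) assoc)

    SumRel-ι₁ : R₂ ¡ ¡ → ∀ {W} {p : Hom W X₁} {r : Hom W Y₁} → R₁ p r → SumRel R₁ R₂ (ι₁ ∘ p) (ι₁ ∘ r)
    SumRel-ι₁ rel¡ {W} {p} {r} rel = split W 𝟘 ι₁ p r ¡ ¡ rel rel¡ (Equiv.sym ι₁-β) (Equiv.sym ι₁-β)

    SumRel-ι₂ : R₁ ¡ ¡ → ∀ {W} {p : Hom W X₂} {r : Hom W Y₂} → R₂ p r → SumRel R₁ R₂ (ι₂ ∘ p) (ι₂ ∘ r)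
    SumRel-ι₂ rel¡ {W} {p} {r} rel = split 𝟘 W ι₂ ¡ ¡ p r rel¡ rel (Equiv.sym ι₂-β) (Equiv.sym ι₂-β)

    SumRel-copair : CopairClosed R₁ → CopairClosed R₂ → CopairClosed (SumRel R₁ R₂)
    SumRel-copair cl₁ cl₂ (split W₁ W₂ u p₁ r₁ p₂ r₂ rel₁ rel₂ ex ey)
                          (split W₁' W₂' u' p₁' r₁' p₂' r₂' rel₁' rel₂' ex' ey') =
      split (W₁ ⊕ W₁') (W₂ ⊕ W₂') [ (ι₁ ⊕₁ ι₁) ∘ u , (ι₂ ⊕₁ ι₂) ∘ u' ]
            [ p₁ , p₁' ] [ r₁ , r₁' ] [ p₂ , p₂' ] [ r₂ , r₂' ] (cl₁ rel₁ rel₁') (cl₂ rel₂ rel₂')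
            (copair-factors ex ex') (copair-factors ey ey')
      where
      copair-factors : ∀ {Z₁ Z₂ A₁ A₂ A₁' A₂' Q₁ Q₂} {a₁ : Hom A₁ Q₁} {a₂ : Hom A₂ Q₂}
                         {a₁' : Hom A₁' Q₁} {a₂' : Hom A₂' Q₂} {v : Hom Z₁ (A₁ ⊕ A₂)} {v' : Hom Z₂ (A₁' ⊕ A₂')}
                         {x : Hom Z₁ (Q₁ ⊕ Q₂)} {x' : Hom Z₂ (Q₁ ⊕ Q₂)} →
                       x ≈ (a₁ ⊕₁ a₂) ∘ v → x' ≈ (a₁' ⊕₁ a₂') ∘ v' →
                       [ x , x' ] ≈ ([ a₁ , a₁' ] ⊕₁ [ a₂ , a₂' ]) ∘ [ (ι₁ ⊕₁ ι₁) ∘ v , (ι₂ ⊕₁ ι₂) ∘ v' ]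
      copair-factors px px' = Equiv.sym (Equiv.trans ∘[] ([]-cong
        (Equiv.trans (pullˡ (Equiv.trans ⊕₁∘⊕₁ (⊕₁-cong ι₁-β ι₁-β))) (Equiv.sym px))
        (Equiv.trans (pullˡ (Equiv.trans ⊕₁∘⊕₁ (⊕₁-cong ι₂-β ι₂-β))) (Equiv.sym px'))))

  module MT = StrongMonadProperties S T
  module MU = StrongMonadProperties S U

  α-st∘⟨⟩ : ∀ {Z X Y} {a : Hom Z X} {b : Hom Z (T.T₀ Y)} → α ∘ T.st ∘ ⟨ a , b ⟩ ≈ U.st ∘ ⟨ a , α ∘ b ⟩
  α-st∘⟨⟩ = Equiv.trans (pullˡ α-st) (Equiv.trans (pullʳ ⊗₁∘⟨⟩) (refl⟩∘⟨ ⟨⟩-cong identityˡ Equiv.refl))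

  α-kleisli : ∀ {Z X Y} {f : Hom X (T.T₀ Y)} {g : Hom Z (T.T₀ X)} →
              U.μ ∘ U.T₁ (α ∘ f) ∘ α ∘ g ≈ α ∘ T.μ ∘ T.T₁ f ∘ g
  α-kleisli {f = f} {g} = begin
    U.μ ∘ U.T₁ (α ∘ f) ∘ α ∘ g    ≈⟨ refl⟩∘⟨ pushˡ U.T₁-∘ ⟩
    U.μ ∘ U.T₁ α ∘ U.T₁ f ∘ α ∘ g ≈⟨ refl⟩∘⟨ refl⟩∘⟨ extendʳ α-natural ⟨
    U.μ ∘ U.T₁ α ∘ α ∘ T.T₁ f ∘ g ≈⟨ Equiv.trans (Equiv.sym assoc²) (pushˡ (Equiv.sym α-μ)) ⟩
    α ∘ T.μ ∘ T.T₁ f ∘ g          ∎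

  module _ {X Y} {R : GRel X Y} where

    CompRel-resp : ∀ {Z} {c c' : Hom Z (T.T₀ X)} {d d' : Hom Z (U.T₀ Y)} →
                   c ≈ c' → d ≈ d' → CompRel R c d → CompRel R c' d'
    CompRel-resp pc pd (span W w p r rel ec ed) =
      span W w p r rel (Equiv.trans (Equiv.sym pc) ec) (Equiv.trans (Equiv.sym pd) ed)

    CompRel-reindex : Reindexable (CompRel R)
    CompRel-reindex h (span W w p r rel ec ed) =
      span W (w ∘ h) p r rel (Equiv.trans (ec ⟩∘⟨refl) assoc) (Equiv.trans (ed ⟩∘⟨refl) assoc²)

    CompRel-η : ∀ {Z} {x : Hom Z X} {y : Hom Z Y} → R x y → CompRel R (T.η ∘ x) (U.η ∘ y)
    CompRel-η {x = x} {y} rel =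
      span _ T.η x y rel T.η-natural (Equiv.trans U.η-natural (refl⟩∘⟨ Equiv.sym α-η))

    CompRel-copair : CopairClosed R → CopairClosed (CompRel R)
    CompRel-copair cl (span W₁ w₁ p₁ r₁ rel₁ ec₁ ed₁) (span W₂ w₂ p₂ r₂ rel₂ ec₂ ed₂) =
      span (W₁ ⊕ W₂) [ T.T₁ ι₁ ∘ w₁ , T.T₁ ι₂ ∘ w₂ ] [ p₁ , p₂ ] [ r₁ , r₂ ] (cl rel₁ rel₂)
        (Equiv.sym (Equiv.trans MT.T₁[]∘[T₁ι₁,T₁ι₂] ([]-cong (Equiv.sym ec₁) (Equiv.sym ec₂))))
        (Equiv.sym (Equiv.trans (refl⟩∘⟨ Equiv.trans ∘[] ([]-cong (extendʳ α-natural) (extendʳ α-natural)))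
                   (Equiv.trans MU.T₁[]∘[T₁ι₁,T₁ι₂] ([]-cong (Equiv.sym ed₁) (Equiv.sym ed₂)))))

    CompRel-weaken : ∀ {R' : GRel X Y} → (∀ {W} {p : Hom W X} {r : Hom W Y} → R p r → R' p r) →
                     ∀ {Z} {c : Hom Z (T.T₀ X)} {d : Hom Z (U.T₀ Y)} → CompRel R c d → CompRel R' c d
    CompRel-weaken sub (span W w p r rel ec ed) = span W w p r (sub rel) ec ed

    CompRel-map : ∀ {X' Y'} {R' : GRel X' Y'} {f : Hom X X'} {g : Hom Y Y'} →
                  (∀ {W} {p : Hom W X} {r : Hom W Y} → R p r → R' (f ∘ p) (g ∘ r)) →
                  ∀ {Z} {c : Hom Z (T.T₀ X)} {d : Hom Z (U.T₀ Y)} →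
                  CompRel R c d → CompRel R' (T.T₁ f ∘ c) (U.T₁ g ∘ d)
    CompRel-map fr (span W w _ _ rel ec ed) = span W w _ _ (fr rel)
      (Equiv.trans (refl⟩∘⟨ ec) (pullˡ (Equiv.sym T.T₁-∘)))
      (Equiv.trans (refl⟩∘⟨ ed) (pullˡ (Equiv.sym U.T₁-∘)))

    CompRel-strength : Reindexable R → ∀ {Z E E'} (e : Hom Z E) (e' : Hom Z E')
                       {c : Hom Z (T.T₀ X)} {d : Hom Z (U.T₀ Y)} → CompRel R c d →
                       CompRel (WithEnv e e' R) (T.st ∘ ⟨ e , c ⟩) (U.st ∘ ⟨ e' , d ⟩)
    CompRel-strength reindex {Z} e e' {c} {d} (span W w p r rel ec ed) =
      span (Z ⊗ W) (T.st ∘ ⟨ id , w ⟩) (e ⊗₁ p) (e' ⊗₁ r)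
           (at π₁ (p ∘ π₂) (r ∘ π₂) (reindex π₂ rel) Equiv.refl Equiv.refl) ec' ed'
      where
      ec' : T.st ∘ ⟨ e , c ⟩ ≈ T.T₁ (e ⊗₁ p) ∘ T.st ∘ ⟨ id , w ⟩
      ec' = begin
        T.st ∘ ⟨ e , c ⟩                  ≈⟨ refl⟩∘⟨ ⟨⟩-cong Equiv.refl ec ⟩
        T.st ∘ ⟨ e , T.T₁ p ∘ w ⟩         ≈⟨ refl⟩∘⟨ ⟨⟩-factor ⟩
        T.st ∘ (e ⊗₁ T.T₁ p) ∘ ⟨ id , w ⟩ ≈⟨ extendʳ T.st-natural ⟩
        T.T₁ (e ⊗₁ p) ∘ T.st ∘ ⟨ id , w ⟩ ∎
      ed' : U.st ∘ ⟨ e' , d ⟩ ≈ U.T₁ (e' ⊗₁ r) ∘ α ∘ T.st ∘ ⟨ id , w ⟩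
      ed' = begin
        U.st ∘ ⟨ e' , d ⟩                      ≈⟨ refl⟩∘⟨ ⟨⟩-cong Equiv.refl ed ⟩
        U.st ∘ ⟨ e' , U.T₁ r ∘ α ∘ w ⟩         ≈⟨ refl⟩∘⟨ ⟨⟩-factor ⟩
        U.st ∘ (e' ⊗₁ U.T₁ r) ∘ ⟨ id , α ∘ w ⟩ ≈⟨ extendʳ U.st-natural ⟩
        U.T₁ (e' ⊗₁ r) ∘ U.st ∘ ⟨ id , α ∘ w ⟩ ≈⟨ refl⟩∘⟨ α-st∘⟨⟩ ⟨
        U.T₁ (e' ⊗₁ r) ∘ α ∘ T.st ∘ ⟨ id , w ⟩ ∎

    CompRel-kleisli : ∀ {X' Y'} {R' : GRel X' Y'} {k : Hom X (T.T₀ X')} {k' : Hom Y (U.T₀ Y')} →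
                      (∀ {W} {p : Hom W X} {r : Hom W Y} → R p r → CompRel R' (k ∘ p) (k' ∘ r)) →
                      ∀ {Z} {c : Hom Z (T.T₀ X)} {d : Hom Z (U.T₀ Y)} →
                      CompRel R c d → CompRel R' (T.μ ∘ T.T₁ k ∘ c) (U.μ ∘ U.T₁ k' ∘ d)
    CompRel-kleisli {k = k} {k'} hyp {c = c} {d} (span _ w p r rel ec ed) with hyp rel
    ... | span W' w' p' r' rel' ec' ed' = span W' (T.μ ∘ T.T₁ w' ∘ w) p' r' rel' ec'' ed''
      where
      ec'' : T.μ ∘ T.T₁ k ∘ c ≈ T.T₁ p' ∘ T.μ ∘ T.T₁ w' ∘ w
      ec'' = begin
        T.μ ∘ T.T₁ k ∘ c                   ≈⟨ refl⟩∘⟨ refl⟩∘⟨ ec ⟩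
        T.μ ∘ T.T₁ k ∘ T.T₁ p ∘ w          ≈⟨ refl⟩∘⟨ pullˡ (Equiv.sym T.T₁-∘) ⟩
        T.μ ∘ T.T₁ (k ∘ p) ∘ w             ≈⟨ refl⟩∘⟨ (T.T₁-cong ec' ⟩∘⟨refl) ⟩
        T.μ ∘ T.T₁ (T.T₁ p' ∘ w') ∘ w      ≈⟨ refl⟩∘⟨ pushˡ T.T₁-∘ ⟩
        T.μ ∘ T.T₁ (T.T₁ p') ∘ T.T₁ w' ∘ w ≈⟨ extendʳ T.μ-natural ⟩
        T.T₁ p' ∘ T.μ ∘ T.T₁ w' ∘ w        ∎
      ed'' : U.μ ∘ U.T₁ k' ∘ d ≈ U.T₁ r' ∘ α ∘ T.μ ∘ T.T₁ w' ∘ w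
      ed'' = begin
        U.μ ∘ U.T₁ k' ∘ d                            ≈⟨ refl⟩∘⟨ refl⟩∘⟨ ed ⟩
        U.μ ∘ U.T₁ k' ∘ U.T₁ r ∘ α ∘ w               ≈⟨ refl⟩∘⟨ pullˡ (Equiv.sym U.T₁-∘) ⟩
        U.μ ∘ U.T₁ (k' ∘ r) ∘ α ∘ w                  ≈⟨ refl⟩∘⟨ (U.T₁-cong ed' ⟩∘⟨refl) ⟩
        U.μ ∘ U.T₁ (U.T₁ r' ∘ α ∘ w') ∘ α ∘ w        ≈⟨ refl⟩∘⟨ pushˡ U.T₁-∘ ⟩
        U.μ ∘ U.T₁ (U.T₁ r') ∘ U.T₁ (α ∘ w') ∘ α ∘ w ≈⟨ extendʳ U.μ-natural ⟩
        U.T₁ r' ∘ U.μ ∘ U.T₁ (α ∘ w') ∘ α ∘ w        ≈⟨ refl⟩∘⟨ α-kleisli ⟩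
        U.T₁ r' ∘ α ∘ T.μ ∘ T.T₁ w' ∘ w              ∎

  CompRel-bind : ∀ {X Y} {R : GRel X Y} → Reindexable R →
                 ∀ {X' Y' E E' Z} {R' : GRel X' Y'} (e : Hom Z E) (e' : Hom Z E')
                 (k : Hom (E ⊗ X) (T.T₀ X')) (k' : Hom (E' ⊗ Y) (U.T₀ Y')) →
                 (∀ {W} (h : Hom W Z) {p : Hom W X} {r : Hom W Y} → R p r →
                    CompRel R' (k ∘ ⟨ e ∘ h , p ⟩) (k' ∘ ⟨ e' ∘ h , r ⟩)) →
                 ∀ {c : Hom Z (T.T₀ X)} {d : Hom Z (U.T₀ Y)} →
                 CompRel R c d → CompRel R' (MT.strongBind k e c) (MU.strongBind k' e' d)
  CompRel-bind reindex e e' k k' hyp crel = CompRel-kleisli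
    (λ { (at h p r rel ex ey) → CompRel-resp (refl⟩∘⟨ Equiv.sym ex) (refl⟩∘⟨ Equiv.sym ey) (hyp h rel) })
    (CompRel-strength reindex e e' crel)

  CompRel-query : ∀ {ΩT ΩU} {τT : EMAlgebra S T ΩT} {τU : EMAlgebra S U ΩU}
                  (query : InferenceQuery S φ τT τU) → let open InferenceQuery query in
                  ∀ {X Y} {R : GRel X Y} {P : Hom X ΩT} {P' : Hom Y ΩU} →
                  (∀ {W} {p : Hom W X} {r : Hom W Y} → R p r → q ∘ P ∘ p ≈ P' ∘ r) →
                  ∀ {Z} {c : Hom Z (T.T₀ X)} {d : Hom Z (U.T₀ Y)} → CompRel R c d →
                  q ∘ EMAlgebra.τ τT ∘ T.T₁ P ∘ c ≈ EMAlgebra.τ τU ∘ U.T₁ P' ∘ d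
  CompRel-query {τT = τT} {τU} query {P = P} {P'} hyp {c = c} {d} (span _ w p r rel ec ed) = begin
    q ∘ τT.τ ∘ T.T₁ P ∘ c                ≈⟨ refl⟩∘⟨ refl⟩∘⟨ refl⟩∘⟨ ec ⟩
    q ∘ τT.τ ∘ T.T₁ P ∘ T.T₁ p ∘ w       ≈⟨ refl⟩∘⟨ refl⟩∘⟨ pullˡ (Equiv.sym T.T₁-∘) ⟩
    q ∘ τT.τ ∘ T.T₁ (P ∘ p) ∘ w          ≈⟨ Equiv.trans (pullˡ q-hom) assoc² ⟩
    τU.τ ∘ U.T₁ q ∘ α ∘ T.T₁ (P ∘ p) ∘ w ≈⟨ refl⟩∘⟨ refl⟩∘⟨ extendʳ α-natural ⟩
    τU.τ ∘ U.T₁ q ∘ U.T₁ (P ∘ p) ∘ α ∘ w ≈⟨ refl⟩∘⟨ pullˡ (Equiv.sym U.T₁-∘) ⟩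
    τU.τ ∘ U.T₁ (q ∘ P ∘ p) ∘ α ∘ w      ≈⟨ refl⟩∘⟨ (U.T₁-cong (hyp rel) ⟩∘⟨refl) ⟩
    τU.τ ∘ U.T₁ (P' ∘ r) ∘ α ∘ w         ≈⟨ refl⟩∘⟨ pushˡ U.T₁-∘ ⟩
    τU.τ ∘ U.T₁ P' ∘ U.T₁ r ∘ α ∘ w      ≈⟨ refl⟩∘⟨ refl⟩∘⟨ ed ⟨
    τU.τ ∘ U.T₁ P' ∘ d                   ∎
    where
    open InferenceQuery query
    module τT = EMAlgebra τT
    module τU = EMAlgebra τU

  -- Hom-sets into 𝟏, and by strictness into 𝟘, have at most one element.
  Val : (t : Ty B) → GRel IT.⟦ t ⟧ty IU.⟦ t ⟧ty
  Val (base b) x y = Lift L (x ≈ y)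
  Val 𝟏 x y = ⊤
  Val (s ×ᵗ t) x y = Val s (π₁ ∘ x) (π₁ ∘ y) × Val t (π₂ ∘ x) (π₂ ∘ y)
  Val 𝟎 x y = ⊤
  Val (s +ᵗ t) x y = SumRel (Val s) (Val t) x y
  Val (s ⇒ t) {Z} f g = ∀ {Z'} (h : Hom Z' Z) {x y} → Val s x y →
                        CompRel (Val t) (ev ∘ ⟨ f ∘ h , x ⟩) (ev ∘ ⟨ g ∘ h , y ⟩)

  Comp : (t : Ty B) → GRel (T.T₀ IT.⟦ t ⟧ty) (U.T₀ IU.⟦ t ⟧ty)
  Comp t = CompRel (Val t)

  Val-resp : ∀ t {Z} {x x' : Hom Z IT.⟦ t ⟧ty} {y y' : Hom Z IU.⟦ t ⟧ty} →
             x ≈ x' → y ≈ y' → Val t x y → Val t x' y'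
  Val-resp (base b) px py v = lift (Equiv.trans (Equiv.sym px) (Equiv.trans (lower v) py))
  Val-resp 𝟏 px py v = tt
  Val-resp (s ×ᵗ t) px py (v₁ , v₂) =
    Val-resp s (refl⟩∘⟨ px) (refl⟩∘⟨ py) v₁ , Val-resp t (refl⟩∘⟨ px) (refl⟩∘⟨ py) v₂
  Val-resp 𝟎 px py v = tt
  Val-resp (s +ᵗ t) px py v = SumRel-resp px py v
  Val-resp (s ⇒ t) px py v h vx = CompRel-resp (refl⟩∘⟨ ⟨⟩-cong (px ⟩∘⟨refl) Equiv.refl)
                                               (refl⟩∘⟨ ⟨⟩-cong (py ⟩∘⟨refl) Equiv.refl) (v h vx)

  Val-reindex : ∀ t → Reindexable (Val t)
  Val-reindex (base b) h v = lift (lower v ⟩∘⟨refl)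
  Val-reindex 𝟏 h v = tt
  Val-reindex (s ×ᵗ t) h (v₁ , v₂) =
    Val-resp s assoc assoc (Val-reindex s h v₁) , Val-resp t assoc assoc (Val-reindex t h v₂)
  Val-reindex 𝟎 h v = tt
  Val-reindex (s +ᵗ t) h v = SumRel-reindex h v
  Val-reindex (s ⇒ t) h v h' vx = CompRel-resp (refl⟩∘⟨ ⟨⟩-cong sym-assoc Equiv.refl)
                                               (refl⟩∘⟨ ⟨⟩-cong sym-assoc Equiv.refl) (v (h ∘ h') vx)

  Val-¡ : ∀ t → Val t ¡ ¡
  Val-¡ (base b) = lift ¡-unique₂
  Val-¡ 𝟏 = tt
  Val-¡ (s ×ᵗ t) = Val-resp s ¡-unique₂ ¡-unique₂ (Val-¡ s) , Val-resp t ¡-unique₂ ¡-unique₂ (Val-¡ t)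
  Val-¡ 𝟎 = tt
  Val-¡ (s +ᵗ t) = split 𝟘 𝟘 ¡ ¡ ¡ ¡ ¡ (Val-¡ s) (Val-¡ t) ¡-unique₂ ¡-unique₂
  Val-¡ (s ⇒ t) h vx = span 𝟘 (T.η ∘ h) ¡ ¡ (Val-¡ t) (𝟘-strict h) (𝟘-strict h)

  Val-copair : ∀ t → CopairClosed (Val t)
  Val-copair (base b) v₁ v₂ = lift ([]-cong (lower v₁) (lower v₂))
  Val-copair 𝟏 v₁ v₂ = tt
  Val-copair (s ×ᵗ t) (v₁ , v₂) (v₁' , v₂') =
    Val-resp s (Equiv.sym ∘[]) (Equiv.sym ∘[]) (Val-copair s v₁ v₁') ,
    Val-resp t (Equiv.sym ∘[]) (Equiv.sym ∘[]) (Val-copair t v₂ v₂')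
  Val-copair 𝟎 v₁ v₂ = tt
  Val-copair (s +ᵗ t) v₁ v₂ = SumRel-copair (Val-copair s) (Val-copair t) v₁ v₂
  -- By stability Z' splits into the pullbacks of ι₁ and ι₂ along h, on each of which
  -- h factors through one summand.
  Val-copair (s ⇒ t) {W₁} {W₂} v₁ v₂ {Z'} h vx with stable h
  ... | _ , _ , i₁ , k₁ , i₂ , k₂ , (sq₁ , _) , (sq₂ , _) , (j , _ , [i₁,i₂]∘j≈id) =
    CompRel-resp reassemble reassemble (CompRel-reindex j (CompRel-copair (Val-copair t)
      (CompRel-resp (Equiv.sym (restrict sq₁ ι₁-β)) (Equiv.sym (restrict sq₁ ι₁-β)) (v₁ k₁ (Val-reindex s i₁ vx)))
      (CompRel-resp (Equiv.sym (restrict sq₂ ι₂-β)) (Equiv.sym (restrict sq₂ ι₂-β)) (v₂ k₂ (Val-reindex s i₂ vx)))))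
    where
    reassemble : ∀ {Q} {c : Hom Z' Q} → [ c ∘ i₁ , c ∘ i₂ ] ∘ j ≈ c
    reassemble = Equiv.trans (Equiv.sym ∘[] ⟩∘⟨refl)
                             (Equiv.trans assoc (Equiv.trans (refl⟩∘⟨ [i₁,i₂]∘j≈id) identityʳ))
    restrict : ∀ {P Zᵢ X Y} {F : Hom (W₁ ⊕ W₂) (Exp X Y)} {ι : Hom Zᵢ (W₁ ⊕ W₂)} {f : Hom Zᵢ (Exp X Y)}
                 {i : Hom P Z'} {k : Hom P Zᵢ} {a : Hom Z' Y} → h ∘ i ≈ ι ∘ k → F ∘ ι ≈ f →
               (ev ∘ ⟨ F ∘ h , a ⟩) ∘ i ≈ ev ∘ ⟨ f ∘ k , a ∘ i ⟩
    restrict sq Fι = pullʳ (Equiv.trans ⟨⟩∘ (⟨⟩-cong (Equiv.trans (pullʳ sq) (pullˡ Fι)) Equiv.refl))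

  Val-pair : ∀ s t {Z} {a : Hom Z IT.⟦ s ⟧ty} {a' : Hom Z IU.⟦ s ⟧ty} {b : Hom Z IT.⟦ t ⟧ty} {b' : Hom Z IU.⟦ t ⟧ty} →
             Val s a a' → Val t b b' → Val (s ×ᵗ t) ⟨ a , b ⟩ ⟨ a' , b' ⟩
  Val-pair s t va vb = Val-resp s (Equiv.sym π₁-β) (Equiv.sym π₁-β) va , Val-resp t (Equiv.sym π₂-β) (Equiv.sym π₂-β) vb

  Val-from-𝟘 : ∀ t {Z} (p : Hom Z 𝟘) {r : Hom Z 𝟘} → Val t (¡ ∘ p) (¡ ∘ r)
  Val-from-𝟘 t p = Val-resp t Equiv.refl (𝟘-strict p) (Val-reindex t p (Val-¡ t))

  Val-ground⇒ : ∀ g {Z} {x : Hom Z IT.⟦ ⌜ g ⌝ ⟧ty} {y : Hom Z IU.⟦ ⌜ g ⌝ ⟧ty} →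
                Val ⌜ g ⌝ x y → GT.to g ∘ x ≈ GU.to g ∘ y
  Val-ground⇒ (base b) v = refl⟩∘⟨ lower v
  Val-ground⇒ 𝟏 v = !-unique₂
  Val-ground⇒ 𝟎 {x = x} v = 𝟘-strict x
  Val-ground⇒ (g ×ᵍ h) {x = x} {y} (v₁ , v₂) = begin
    GT.to (g ×ᵍ h) ∘ x                      ≈⟨ Equiv.trans (GT.to-×ᵍ g h ⟩∘⟨refl) ⊗₁∘ ⟩
    ⟨ GT.to g ∘ π₁ ∘ x , GT.to h ∘ π₂ ∘ x ⟩ ≈⟨ ⟨⟩-cong (Val-ground⇒ g v₁) (Val-ground⇒ h v₂) ⟩
    ⟨ GU.to g ∘ π₁ ∘ y , GU.to h ∘ π₂ ∘ y ⟩ ≈⟨ Equiv.trans (GU.to-×ᵍ g h ⟩∘⟨refl) ⊗₁∘ ⟨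
    GU.to (g ×ᵍ h) ∘ y                      ∎
  Val-ground⇒ (g +ᵍ h) {x = x} {y} (split _ _ u p₁ r₁ p₂ r₂ v₁ v₂ ex ey) = begin
    GT.to (g +ᵍ h) ∘ x                     ≈⟨ GT.to-+ᵍ g h ⟩∘⟨ ex ⟩
    (GT.to g ⊕₁ GT.to h) ∘ (p₁ ⊕₁ p₂) ∘ u  ≈⟨ pullˡ ⊕₁∘⊕₁ ⟩
    ((GT.to g ∘ p₁) ⊕₁ (GT.to h ∘ p₂)) ∘ u ≈⟨ ⊕₁-cong (Val-ground⇒ g v₁) (Val-ground⇒ h v₂) ⟩∘⟨refl ⟩
    ((GU.to g ∘ r₁) ⊕₁ (GU.to h ∘ r₂)) ∘ u ≈⟨ pullˡ ⊕₁∘⊕₁ ⟨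
    (GU.to g ⊕₁ GU.to h) ∘ (r₁ ⊕₁ r₂) ∘ u  ≈⟨ GU.to-+ᵍ g h ⟩∘⟨ ey ⟨
    GU.to (g +ᵍ h) ∘ y                     ∎

  from-agree : ∀ g → GT.to g ∘ GT.from g ≈ GU.to g ∘ GU.from g
  from-agree g = Equiv.trans (GT.to∘from g) (Equiv.sym (GU.to∘from g))

  Val-ground⇐ : ∀ g {Z} {x : Hom Z IT.⟦ ⌜ g ⌝ ⟧ty} {y : Hom Z IU.⟦ ⌜ g ⌝ ⟧ty} →
                GT.to g ∘ x ≈ GU.to g ∘ y → Val ⌜ g ⌝ x y
  Val-ground⇐ (base b) agree = lift (Equiv.trans (Equiv.sym identityˡ) (Equiv.trans agree identityˡ))
  Val-ground⇐ 𝟏 agree = tt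
  Val-ground⇐ 𝟎 agree = tt
  Val-ground⇐ (g ×ᵍ h) agree =
    let agree₁ , agree₂ = ⊗₁∘-components (Equiv.trans (Equiv.sym (GT.to-×ᵍ g h) ⟩∘⟨refl)
                                                      (Equiv.trans agree (GU.to-×ᵍ g h ⟩∘⟨refl)))
    in Val-ground⇐ g agree₁ , Val-ground⇐ h agree₂
  -- both sides factor through GT.to (g +ᵍ h) ∘ x : Z → ⟦ g ⟧g A ⊕ ⟦ h ⟧g A
  Val-ground⇐ (g +ᵍ h) {x = x} {y} agree =
    split _ _ (GT.to (g +ᵍ h) ∘ x) (GT.from g) (GU.from g) (GT.from h) (GU.from h)
          (Val-ground⇐ g (from-agree g)) (Val-ground⇐ h (from-agree h))
          (Equiv.sym (cancelˡ (GT.[from⊕₁from]∘to g h)))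
          (Equiv.sym (Equiv.trans (refl⟩∘⟨ agree) (cancelˡ (GU.[from⊕₁from]∘to g h))))

  Val-ground-from : ∀ g → Val ⌜ g ⌝ (GT.from g) (GU.from g)
  Val-ground-from g = Val-ground⇐ g (from-agree g)

  Val-ground-map : ∀ g g' (f : Hom (⟦ g ⟧g A) (⟦ g' ⟧g A)) {Z} {x : Hom Z IT.⟦ ⌜ g ⌝ ⟧ty} {y : Hom Z IU.⟦ ⌜ g ⌝ ⟧ty} →
                   Val ⌜ g ⌝ x y → Val ⌜ g' ⌝ ((GT.from g' ∘ f ∘ GT.to g) ∘ x) ((GU.from g' ∘ f ∘ GU.to g) ∘ y)
  Val-ground-map g g' f {x = x} {y} v = Val-ground⇐ g' (begin
    GT.to g' ∘ (GT.from g' ∘ f ∘ GT.to g) ∘ x ≈⟨ Equiv.trans (refl⟩∘⟨ assoc²) (cancelˡ (GT.to∘from g')) ⟩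
    f ∘ GT.to g ∘ x                           ≈⟨ refl⟩∘⟨ Val-ground⇒ g v ⟩
    f ∘ GU.to g ∘ y                           ≈⟨ Equiv.trans (refl⟩∘⟨ assoc²) (cancelˡ (GU.to∘from g')) ⟨
    GU.to g' ∘ (GU.from g' ∘ f ∘ GU.to g) ∘ y ∎)

  Comp-ground-effect : ∀ g g' (f : Hom (⟦ g ⟧g A) (T.T₀ (⟦ g' ⟧g A))) {Z}
                         {x : Hom Z IT.⟦ ⌜ g ⌝ ⟧ty} {y : Hom Z IU.⟦ ⌜ g ⌝ ⟧ty} → Val ⌜ g ⌝ x y →
                       Comp ⌜ g' ⌝ ((T.T₁ (GT.from g') ∘ f ∘ GT.to g) ∘ x) ((U.T₁ (GU.from g') ∘ (α ∘ f) ∘ GU.to g) ∘ y)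
  Comp-ground-effect g g' f {x = x} {y} v =
    span (⟦ g' ⟧g A) (f ∘ GT.to g ∘ x) (GT.from g') (GU.from g') (Val-ground-from g') assoc² (begin
      (U.T₁ (GU.from g') ∘ (α ∘ f) ∘ GU.to g) ∘ y ≈⟨ Equiv.trans assoc² (refl⟩∘⟨ assoc) ⟩
      U.T₁ (GU.from g') ∘ α ∘ f ∘ GU.to g ∘ y     ≈⟨ refl⟩∘⟨ refl⟩∘⟨ refl⟩∘⟨ Val-ground⇒ g v ⟨
      U.T₁ (GU.from g') ∘ α ∘ f ∘ GT.to g ∘ x     ∎)

  Env : (Γ : Ctx B) → GRel IT.⟦ Γ ⟧ctx IU.⟦ Γ ⟧ctx
  Env ∅ x y = ⊤
  Env (Γ ▸ t) x y = Env Γ (π₁ ∘ x) (π₁ ∘ y) × Val t (π₂ ∘ x) (π₂ ∘ y)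

  Env-resp : ∀ Γ {Z} {x x' : Hom Z IT.⟦ Γ ⟧ctx} {y y' : Hom Z IU.⟦ Γ ⟧ctx} →
             x ≈ x' → y ≈ y' → Env Γ x y → Env Γ x' y'
  Env-resp ∅ px py v = tt
  Env-resp (Γ ▸ t) px py (vΓ , vt) =
    Env-resp Γ (refl⟩∘⟨ px) (refl⟩∘⟨ py) vΓ , Val-resp t (refl⟩∘⟨ px) (refl⟩∘⟨ py) vt

  Env-reindex : ∀ Γ → Reindexable (Env Γ)
  Env-reindex ∅ h v = tt
  Env-reindex (Γ ▸ t) h (vΓ , vt) =
    Env-resp Γ assoc assoc (Env-reindex Γ h vΓ) , Val-resp t assoc assoc (Val-reindex t h vt)

  Env-extend : ∀ {Γ t Z} {γ : Hom Z IT.⟦ Γ ⟧ctx} {γ' : Hom Z IU.⟦ Γ ⟧ctx}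
                 {x : Hom Z IT.⟦ t ⟧ty} {y : Hom Z IU.⟦ t ⟧ty} →
               Env Γ γ γ' → Val t x y → Env (Γ ▸ t) ⟨ γ , x ⟩ ⟨ γ' , y ⟩
  Env-extend {Γ} {t} vΓ vt =
    Env-resp Γ (Equiv.sym π₁-β) (Equiv.sym π₁-β) vΓ , Val-resp t (Equiv.sym π₂-β) (Equiv.sym π₂-β) vt

  Env-lookup : ∀ {Γ t} (i : Γ ∋ t) {Z} {γ : Hom Z IT.⟦ Γ ⟧ctx} {γ' : Hom Z IU.⟦ Γ ⟧ctx} →
               Env Γ γ γ' → Val t (IT.⟦ i ⟧var ∘ γ) (IU.⟦ i ⟧var ∘ γ')
  Env-lookup here (_ , vt) = vt
  Env-lookup {t = t} (there i) (vΓ , _) = Val-resp t sym-assoc sym-assoc (Env-lookup i vΓ)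

  Env-ground⇐ : ∀ Γ {Z} {x : Hom Z IT.⟦ ⌜ Γ ⌝c ⟧ctx} {y : Hom Z IU.⟦ ⌜ Γ ⌝c ⟧ctx} →
                GT.toᶜ Γ ∘ x ≈ GU.toᶜ Γ ∘ y → Env ⌜ Γ ⌝c x y
  Env-ground⇐ ∅ agree = tt
  Env-ground⇐ (Γ ▸ g) agree =
    let agree₁ , agree₂ = ⊗₁∘-components (Equiv.trans (Equiv.sym (GT.toᶜ-▸ Γ g) ⟩∘⟨refl)
                                                      (Equiv.trans agree (GU.toᶜ-▸ Γ g ⟩∘⟨refl)))
    in Env-ground⇐ Γ agree₁ , Val-ground⇐ g agree₂

  Env-ground-fromᶜ : ∀ Γ → Env ⌜ Γ ⌝c (GT.fromᶜ Γ) (GU.fromᶜ Γ)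
  Env-ground-fromᶜ Γ = Env-ground⇐ Γ (Equiv.trans (GT.toᶜ∘fromᶜ Γ) (Equiv.sym (GU.toᶜ∘fromᶜ Γ)))

  Related : ∀ Γ t → Hom IT.⟦ Γ ⟧ctx (T.T₀ IT.⟦ t ⟧ty) → Hom IU.⟦ Γ ⟧ctx (U.T₀ IU.⟦ t ⟧ty) → Set L
  Related Γ t m m' = ∀ {Z} {γ : Hom Z IT.⟦ Γ ⟧ctx} {γ' : Hom Z IU.⟦ Γ ⟧ctx} → Env Γ γ γ' → Comp t (m ∘ γ) (m' ∘ γ')

  Related-var : ∀ {Γ t} (i : Γ ∋ t) → Related Γ t (T.η ∘ IT.⟦ i ⟧var) (U.η ∘ IU.⟦ i ⟧var)
  Related-var i vγ = CompRel-resp sym-assoc sym-assoc (CompRel-η (Env-lookup i vγ))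

  Related-unit : ∀ {Γ} → Related Γ 𝟏 (T.η ∘ !) (U.η ∘ !)
  Related-unit vγ = CompRel-resp sym-assoc sym-assoc (CompRel-η tt)

  Related-map : ∀ {Γ s t} {f : Hom IT.⟦ s ⟧ty IT.⟦ t ⟧ty} {g : Hom IU.⟦ s ⟧ty IU.⟦ t ⟧ty} →
                (∀ {W} {p : Hom W IT.⟦ s ⟧ty} {r : Hom W IU.⟦ s ⟧ty} → Val s p r → Val t (f ∘ p) (g ∘ r)) →
                ∀ {m m'} → Related Γ s m m' → Related Γ t (T.T₁ f ∘ m) (U.T₁ g ∘ m')
  Related-map fr rel vγ = CompRel-resp sym-assoc sym-assoc (CompRel-map fr (rel vγ))

  Related-effect : ∀ {Γ} g g' (f : Hom (⟦ g ⟧g A) (T.T₀ (⟦ g' ⟧g A))) {m m'} → Related Γ ⌜ g ⌝ m m' →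
                   Related Γ ⌜ g' ⌝ (T.μ ∘ T.T₁ (T.T₁ (GT.from g') ∘ f ∘ GT.to g) ∘ m)
                                    (U.μ ∘ U.T₁ (U.T₁ (GU.from g') ∘ (α ∘ f) ∘ GU.to g) ∘ m')
  Related-effect g g' f rel vγ = CompRel-resp (Equiv.sym assoc²) (Equiv.sym assoc²)
    (CompRel-kleisli (Comp-ground-effect g g' f) (rel vγ))

  Related-pair : ∀ {Γ t₁ t₂ m m' n n'} → Related Γ t₁ m m' → Related Γ t₂ n n' →
                 Related Γ (t₁ ×ᵗ t₂) (T.μ ∘ T.T₁ T.st ∘ T.st' ∘ ⟨ m , n ⟩) (U.μ ∘ U.T₁ U.st ∘ U.st' ∘ ⟨ m' , n' ⟩)
  Related-pair {Γ} {t₁} {t₂} {n = n} {n'} relM relN {γ = γ} {γ'} vγ =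
    CompRel-resp (Equiv.sym MT.pair-as-bind) (Equiv.sym MU.pair-as-bind)
      (CompRel-bind (Val-reindex t₁) (n ∘ γ) (n' ∘ γ') (T.st ∘ swap) (U.st ∘ swap) second (relM vγ))
    where
    second : ∀ {W} (h : Hom W _) {p r} → Val t₁ p r →
             Comp (t₁ ×ᵗ t₂) ((T.st ∘ swap) ∘ ⟨ (n ∘ γ) ∘ h , p ⟩) ((U.st ∘ swap) ∘ ⟨ (n' ∘ γ') ∘ h , r ⟩)
    second h v = CompRel-resp (Equiv.sym (pullʳ swap∘⟨⟩)) (Equiv.sym (pullʳ swap∘⟨⟩))
      (CompRel-weaken (λ { (at h' p₂ r₂ v₂ ex ey) →
                            Val-resp (t₁ ×ᵗ t₂) (Equiv.sym ex) (Equiv.sym ey) (Val-pair t₁ t₂ (Val-reindex t₁ h' v) v₂) })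
        (CompRel-strength (Val-reindex t₂) _ _ (CompRel-resp sym-assoc sym-assoc (relN (Env-reindex Γ h vγ)))))

  Related-case : ∀ {Γ t₁ t₂ t m m' n₁ n₁' n₂ n₂'} → Related Γ (t₁ +ᵗ t₂) m m' →
                 Related (Γ ▸ t₁) t n₁ n₁' → Related (Γ ▸ t₂) t n₂ n₂' →
                 Related Γ t (T.μ ∘ T.T₁ ([ n₁ , n₂ ] ∘ dist) ∘ T.st ∘ ⟨ id , m ⟩)
                             (U.μ ∘ U.T₁ ([ n₁' , n₂' ] ∘ dist) ∘ U.st ∘ ⟨ id , m' ⟩)
  Related-case {Γ} {t₁} {t₂} {t} {n₁ = n₁} {n₁'} {n₂} {n₂'} relM relN₁ relN₂ {γ = γ} {γ'} vγ =
    CompRel-resp (Equiv.sym MT.case-as-bind) (Equiv.sym MU.case-as-bind)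
      (CompRel-bind (Val-reindex (t₁ +ᵗ t₂)) γ γ' _ _ branches (relM vγ))
    where
    branches : ∀ {W} (h : Hom W _) {p r} → Val (t₁ +ᵗ t₂) p r →
               Comp t (([ n₁ , n₂ ] ∘ dist) ∘ ⟨ γ ∘ h , p ⟩) (([ n₁' , n₂' ] ∘ dist) ∘ ⟨ γ' ∘ h , r ⟩)
    branches h (split _ _ u _ _ _ _ v₁ v₂ ex ey) =
      CompRel-resp (Equiv.sym (Equiv.trans (refl⟩∘⟨ ⟨⟩-cong Equiv.refl ex) []∘dist∘⟨,⊕₁∘⟩))
                   (Equiv.sym (Equiv.trans (refl⟩∘⟨ ⟨⟩-cong Equiv.refl ey) []∘dist∘⟨,⊕₁∘⟩))
        (CompRel-reindex (dist ∘ ⟨ id , u ⟩) (CompRel-copair (Val-copair t) (branch relN₁ v₁) (branch relN₂ v₂)))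
      where
      branch : ∀ {s V k k'} → Related (Γ ▸ s) t k k' →
               ∀ {a : Hom V IT.⟦ s ⟧ty} {b : Hom V IU.⟦ s ⟧ty} → Val s a b →
               Comp t (k ∘ ((γ ∘ h) ⊗₁ a)) (k' ∘ ((γ' ∘ h) ⊗₁ b))
      branch {s} relN v = relN (Env-extend (Env-reindex Γ π₁ (Env-reindex Γ h vγ)) (Val-reindex s π₂ v))

  Related-lam : ∀ {Γ s t m m'} → Related (Γ ▸ s) t m m' → Related Γ (s ⇒ t) (T.η ∘ curry m) (U.η ∘ curry m')
  Related-lam {Γ} {s} {t} {m} {m'} relM {γ = γ} {γ'} vγ = CompRel-resp sym-assoc sym-assoc (CompRel-η closure)
    where
    closure : Val (s ⇒ t) (curry m ∘ γ) (curry m' ∘ γ')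
    closure h vx = CompRel-resp (Equiv.sym (Equiv.trans (refl⟩∘⟨ ⟨⟩-cong assoc Equiv.refl) curry-β))
                                (Equiv.sym (Equiv.trans (refl⟩∘⟨ ⟨⟩-cong assoc Equiv.refl) curry-β))
                                (relM (Env-extend (Env-reindex Γ h vγ) vx))

  Related-app : ∀ {Γ s t m m' n n'} → Related Γ (s ⇒ t) m m' → Related Γ s n n' →
                Related Γ t (T.μ ∘ T.T₁ T.μ ∘ T.T₁ (T.T₁ ev) ∘ T.T₁ T.st ∘ T.st' ∘ ⟨ m , n ⟩)
                            (U.μ ∘ U.T₁ U.μ ∘ U.T₁ (U.T₁ ev) ∘ U.T₁ U.st ∘ U.st' ∘ ⟨ m' , n' ⟩)
  Related-app {Γ} {s} {t} {n = n} {n'} relM relN {γ = γ} {γ'} vγ =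
    CompRel-resp (Equiv.sym MT.app-as-bind) (Equiv.sym MU.app-as-bind)
      (CompRel-bind (Val-reindex (s ⇒ t)) (n ∘ γ) (n' ∘ γ') _ _ apply (relM vγ))
    where
    apply : ∀ {W} (h : Hom W _) {f g} → Val (s ⇒ t) f g →
            Comp t (((T.μ ∘ T.T₁ ev ∘ T.st) ∘ swap) ∘ ⟨ (n ∘ γ) ∘ h , f ⟩)
                   (((U.μ ∘ U.T₁ ev ∘ U.st) ∘ swap) ∘ ⟨ (n' ∘ γ') ∘ h , g ⟩)
    apply h {f} {g} vf = CompRel-resp (Equiv.sym (Equiv.trans (pullʳ swap∘⟨⟩) assoc²))
                                      (Equiv.sym (Equiv.trans (pullʳ swap∘⟨⟩) assoc²))
      (CompRel-bind (Val-reindex s) f g ev ev vf (CompRel-resp sym-assoc sym-assoc (relN (Env-reindex Γ h vγ))))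

  fundamental : ∀ {Γ t} (M : Γ ⊢ t) → Related Γ t IT.⟦ M ⟧ IU.⟦ M ⟧
  fundamental (var i) = Related-var i
  fundamental (con c M) = Related-map (Val-ground-map (ar (inj₁ c)) (car (inj₁ c)) (aK c)) (fundamental M)
  fundamental (eff ε M) = Related-effect (ar (inj₂ ε)) (car (inj₂ ε)) (aE ε) (fundamental M)
  fundamental unit = Related-unit
  fundamental (pair M N) = Related-pair (fundamental M) (fundamental N)
  fundamental (fst M) = Related-map proj₁ (fundamental M)
  fundamental (snd M) = Related-map proj₂ (fundamental M)
  fundamental (absurd {t} M) = Related-map {s = 𝟎} (λ {_} {p} _ → Val-from-𝟘 t p) (fundamental M)
  fundamental (inl {t₂ = t₂} M) = Related-map (SumRel-ι₁ (Val-¡ t₂)) (fundamental M)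
  fundamental (inr {t₁} M) = Related-map (SumRel-ι₂ (Val-¡ t₁)) (fundamental M)
  fundamental (case M N₁ N₂) = Related-case (fundamental M) (fundamental N₁) (fundamental N₂)
  fundamental (lam M) = Related-lam (fundamental M)
  fundamental (app M N) = Related-app (fundamental M) (fundamental N)

theorem4p5 : ∀ {o ℓ e} {C : Category o ℓ e} (S : StableBiCCC C) (Sg : Signature)
    (T : StrongMonad S) (𝒜 : Semantics.Structure S Sg T)
    (U : StrongMonad S) (α : MonadMorphism S T U)
    {ΩT ΩU : Category.Obj C} (τT : EMAlgebra S T ΩT) (τU : EMAlgebra S U ΩU)
    (q : InferenceQuery S α τT τU)
    (Γ : GCtx (Signature.B Sg)) (t : GTy (Signature.B Sg))
    (M : Terms._⊢_ Sg (⌜ Γ ⌝c) ⌜ t ⌝)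
    (Q : Category.Hom C (Semantics.⟦_⟧g S Sg t (Semantics.Structure.A 𝒜)) ΩT) →
    Category._≈_ C
      (Category._∘_ C (InferenceQuery.q q)
        (Semantics.Interp.wpG S Sg 𝒜 τT Γ t M Q))
      (Semantics.Interp.wpG S Sg (Semantics.pushStructure S Sg α 𝒜) τU Γ t M
        (Category._∘_ C (InferenceQuery.q q) Q))
theorem4p5 {C = C} S Sg T 𝒜 U α τT τU query Γ t M Q =
  Equiv.trans (refl⟩∘⟨ assoc²)
    (Equiv.trans (CompRel-query query observe (fundamental M (Env-ground-fromᶜ Γ))) (Equiv.sym assoc²))
  where
  open Category C
  open BiCCCProperties S
  open LogicalRelation S Sg α 𝒜
  open InferenceQuery query
  observe : ∀ {W} {p : Hom W IT.⟦ ⌜ t ⌝ ⟧ty} {r : Hom W IU.⟦ ⌜ t ⌝ ⟧ty} → Val ⌜ t ⌝ p r →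
            q ∘ (Q ∘ GT.to t) ∘ p ≈ ((q ∘ Q) ∘ GU.to t) ∘ r
  observe v = Equiv.trans (refl⟩∘⟨ pullʳ (Val-ground⇒ t v)) (Equiv.sym (Equiv.trans assoc assoc))
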